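{- Let $n\ge3$ and $D_n=\langle a,b\mid a^n=b^2=1,\ ab=ba^{ -1}\rangle$. (i) If $n$ is odd with $n=p_1^{\alpha_1}\cdots p_k^{\alpha_k}$ ($p_i$ distinct primes, $\alpha_i\ge1$), then $\Gamma_N(D_n)$ is Eulerian iff $\alpha_i$ is odd for some $i\in\{1,\dots,k\}$. (ii) If $n=2^\alpha$ with $\alpha\ge2$, then $\Gamma_N(D_n)$ is not Eulerian. (iii) If $n=2^\alpha n'$ with $\alpha\ge1$ and $n'=p_1^{\alpha_1}\cdots p_k^{\alpha_k}$ odd ($p_i$ distinct primes, $\alpha_i\ge1$), then $\Gamma_N(D_n)$ is Eulerian iff $\alpha_i$ is odd for some $i\in\{1,\dots,k\}$.
   Context: $\Gamma_N(G)$ denotes the simple graph whose vertices are the proper non-normal subgroups of the group $G$, two distinct vertices $H,K$ being adjacent iff $HK=KH$. Following the paper's convention, a graph is called Eulerian iff every vertex has even degree. -}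

module Defs where

open import Data.Nat as ℕ using (ℕ; zero; suc; NonZero; _≤_; _∸_; _^_)
open import Data.Nat.DivMod using (_mod_)
open import Data.Nat.Divisibility using (_∣_)
open import Data.Nat.Primality using (Prime)
open import Data.Fin as F using (Fin; toℕ; join)
open import Data.Bool using (Bool; true; false; not)
open import Data.Product using (Σ; ∃; ∃₂; _×_; _,_)
open import Data.Sum using (inj₁; inj₂)
open import Data.List using (List; length)
import Data.List.Membership.Propositional as LM
open import Data.List.Relation.Unary.Unique.Propositional using (Unique)
open import Data.Fin.Subset as S using (Subset)
open import Function.Bundles using (_⇔_)
open import Relation.Nullary using (¬_)
open import Relation.Binary.PropositionalEquality using (_≡_; _≢_)

-- The dihedral group D_n = ⟨ a, b | a^n = b^2 = 1, ab = ba⁻¹ ⟩ of order 2n,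
-- realised concretely: the pair (i , s) stands for a^i b^s  (s = true means b).
D : ℕ → Set
D n = Fin n × Bool

module _ (n : ℕ) .{{_ : NonZero n}} where

  addm : Fin n → Fin n → Fin n
  addm i j = (toℕ i ℕ.+ toℕ j) mod n

  negm : Fin n → Fin n
  negm i = (n ∸ toℕ i) mod n

  -- (a^i b^s)(a^j b^t) = a^(i + (-1)^s j) b^(s+t), using b a^j = a^(-j) b
  mul : D n → D n → D n
  mul (i , false) (j , t) = (addm i j , t)
  mul (i , true)  (j , t) = (addm i (negm j) , not t)

  one : D n
  one = (0 mod n , false)

  inv : D n → D n
  inv (i , false) = (negm i , false)
  inv (i , true)  = (i , true)

  -- subsets of D_n, indexed via an injective coding of D_n into Fin (n + n)
  code : D n → Fin (n ℕ.+ n)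
  code (i , false) = join n n (inj₁ i)
  code (i , true)  = join n n (inj₂ i)

  Sub : Set
  Sub = Subset (n ℕ.+ n)

  _∈D_ : D n → Sub → Set
  x ∈D H = code x S.∈ H

  IsSubgroup : Sub → Set
  IsSubgroup H = (one ∈D H)
               × (∀ x y → x ∈D H → y ∈D H → mul x y ∈D H)
               × (∀ x → x ∈D H → inv x ∈D H)

  IsProper : Sub → Set
  IsProper H = ∃ λ x → ¬ (x ∈D H)

  IsNormal : Sub → Set
  IsNormal H = ∀ g h → h ∈D H → mul (mul g h) (inv g) ∈D H

  -- vertices of Γ_N(D_n): proper non-normal subgroups
  IsVertex : Sub → Set
  IsVertex H = IsSubgroup H × IsProper H × ¬ IsNormal H

  ProdSub : Sub → Sub → Set
  ProdSub H K = ∀ h k → h ∈D H → k ∈D K →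
    ∃₂ λ k' h' → k' ∈D K × h' ∈D H × mul h k ≡ mul k' h'

  Permute : Sub → Sub → Set
  Permute H K = ProdSub H K × ProdSub K H

  Adjacent : Sub → Sub → Set
  Adjacent H K = IsVertex K × H ≢ K × Permute H K

  HasCard : (Sub → Set) → ℕ → Set
  HasCard P m = ∃ λ (L : List Sub) →
    Unique L × (∀ K → (K LM.∈ L) ⇔ P K) × length L ≡ m

  Eulerian : Set
  Eulerian = ∀ H → IsVertex H → ∃ λ d → HasCard (Adjacent H) d × 2 ∣ d

prodF : (k : ℕ) → (Fin k → ℕ) → ℕ
prodF zero f = 1
prodF (suc k) f = f F.zero ℕ.* prodF k (λ i → f (F.suc i))

PrimePowerData : (k : ℕ) → (Fin k → ℕ) → (Fin k → ℕ) → Set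
PrimePowerData k p α = (∀ i → Prime (p i)) × (∀ i j → p i ≡ p j → i ≡ j) × (∀ i → 1 ≤ α i)

factorValue : (k : ℕ) → (Fin k → ℕ) → (Fin k → ℕ) → ℕ
factorValue k p α = prodF k (λ i → p i ^ α i)

module Submission where

-- Every vertex H of Γ_N(D_n) contains a reflection τ = a^i b, and conjugation by τ is an
-- involution of the neighbourhood of H, so deg H is congruent mod 2 to the number of τ-invariant
-- neighbours. Every vertex is ⟨a^e, a^j b⟩ with e ∣ n and e ≥ 3; it is τ-invariant iff
-- 2j ≡ 2i (mod e), which has one solution j mod e for odd e and two for even e, and a
-- τ-invariant vertex permutes with H. Hence deg H + 1 is congruent to the number of odd divisors
-- e ≥ 3 of n, i.e. deg H ≡ τ(n') (mod 2) for the odd part n' of n. Pairing d with n'/d shows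
-- that τ(n') is odd exactly when n' is a square, i.e. when every αᵢ is even.

open import Defs
open import Data.Nat.Base using (ℕ; NonZero)
open import Data.Fin.Base using (Fin)

module Parity where

  open import Data.Nat.Base using (ℕ; zero; suc; _+_; _*_; _^_; s≤s; parity)
  open import Data.Parity.Base using (0ℙ)
  open import Data.Parity.Properties using (⁻¹-injective; suc-homo-⁻¹; *-homo-*; *-zeroʳ)
  open import Data.Nat.Properties using (*-cancelʳ-≡; +-identityʳ; *-assoc)
  open import Data.Nat.Divisibility using (_∣_; divides; _∣?_; ∣⇒≤; 0∣⇒≡0)
  open import Data.Nat.Coprimality using (Coprime; coprime-divisor)
  open import Data.Nat.Tactic.RingSolver using (solve-∀)
  open import Data.Sum using (_⊎_; inj₁; inj₂)
  open import Data.Product using (Σ; _×_; _,_)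
  open import Relation.Nullary using (¬_; yes; no; contradiction)
  open import Relation.Binary.PropositionalEquality using (_≡_; refl; sym; trans; cong; subst)

  parity-suc-cong : ∀ m n → parity m ≡ parity n → parity (suc m) ≡ parity (suc n)
  parity-suc-cong m n eq = ⁻¹-injective (trans (suc-homo-⁻¹ m) (trans eq (sym (suc-homo-⁻¹ n))))

  2∣⇒parity≡0ℙ : ∀ {d} → 2 ∣ d → parity d ≡ 0ℙ
  2∣⇒parity≡0ℙ (divides q refl) = trans (*-homo-* q 2) (*-zeroʳ (parity q))

  parity≡0ℙ⇒2∣ : ∀ d → parity d ≡ 0ℙ → 2 ∣ d
  parity≡0ℙ⇒2∣ zero _ = divides 0 refl
  parity≡0ℙ⇒2∣ (suc (suc d)) p with parity≡0ℙ⇒2∣ d p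
  ... | divides q eq = divides (suc q) (cong (λ m → suc (suc m)) eq)

  even-or-odd : ∀ q → (Σ ℕ λ r → q ≡ r * 2) ⊎ (Σ ℕ λ r → q ≡ suc (r * 2))
  even-or-odd zero = inj₁ (0 , refl)
  even-or-odd (suc q) with even-or-odd q
  ... | inj₁ (r , q≡2r)   = inj₂ (r , cong suc q≡2r)
  ... | inj₂ (r , q≡2r+1) = inj₁ (suc r , cong suc q≡2r+1)

  odd⇒coprime-2 : ∀ {e} → ¬ 2 ∣ e → Coprime e 2
  odd⇒coprime-2 e-odd {zero} (_ , 0∣2) with () ← 0∣⇒≡0 0∣2
  odd⇒coprime-2 e-odd {1} _ = refl
  odd⇒coprime-2 e-odd {2} (2∣e , _) = contradiction 2∣e e-odd
  odd⇒coprime-2 e-odd {suc (suc (suc _))} (_ , d∣2) with ∣⇒≤ d∣2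
  ... | s≤s (s≤s ())

  odd-∣-2^a*⇒∣ : ∀ {e} a m → ¬ 2 ∣ e → e ∣ 2 ^ a * m → e ∣ m
  odd-∣-2^a*⇒∣ {e} zero    m e-odd e∣m = subst (e ∣_) (+-identityʳ m) e∣m
  odd-∣-2^a*⇒∣ {e} (suc a) m e-odd e∣2^[1+a]m =
    odd-∣-2^a*⇒∣ a m e-odd (coprime-divisor (odd⇒coprime-2 e-odd) (subst (e ∣_) (*-assoc 2 (2 ^ a) m) e∣2^[1+a]m))

  ∣-double : ∀ e d → e ∣ d + d → e ∣ d ⊎ Σ ℕ λ f → e ≡ f * 2 × Σ ℕ λ q → d ≡ f + q * e
  ∣-double e d e∣2d with 2 ∣? e
  ... | no e-odd = inj₁ (coprime-divisor (odd⇒coprime-2 e-odd) (subst (e ∣_) (ring d) e∣2d))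
    where ring : ∀ d → d + d ≡ 2 * d
          ring = solve-∀
  ... | yes (divides f refl) with e∣2d
  ...   | divides q 2d≡q[2f] with even-or-odd q
  ...     | inj₁ (r , refl) = inj₁ (divides r (*-cancelʳ-≡ d (r * (f * 2)) 2 (trans (ring₁ d) (trans 2d≡q[2f] (ring₂ r f)))))
    where ring₁ : ∀ d → d * 2 ≡ d + d
          ring₁ = solve-∀
          ring₂ : ∀ r f → r * 2 * (f * 2) ≡ r * (f * 2) * 2
          ring₂ = solve-∀
  ...     | inj₂ (r , refl) = inj₂ (f , refl , r , *-cancelʳ-≡ d (f + r * (f * 2)) 2 (trans (ring₁ d) (trans 2d≡q[2f] (ring₂ r f))))
    where ring₁ : ∀ d → d * 2 ≡ d + d
          ring₁ = solve-∀
          ring₂ : ∀ r f → suc (r * 2) * (f * 2) ≡ (f + r * (f * 2)) * 2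
          ring₂ = solve-∀

module Counting where

  open Parity using (parity-suc-cong)

  open import Data.Nat.Base using (suc; _≤_; s≤s; parity)
  open import Data.Nat.Properties using (≤-refl; n≤1+n; ≤-trans; ≤-reflexive)
  open import Data.List.Base using (List; []; _∷_; length; filter)
  open import Data.List.Properties using (filter-accept; filter-reject)
  open import Data.List.Membership.Propositional using (_∈_; _∉_)
  open import Data.List.Membership.Propositional.Properties using (∈-filter⁺; ∈-filter⁻)
  open import Data.List.Membership.Propositional.Properties.WithK using (unique∧set⇒bag)
  open import Data.List.Relation.Binary.BagAndSetEquality using (∼bag⇒↭)
  open import Data.List.Relation.Binary.Permutation.Propositional.Properties using (↭-length)
  open import Data.List.Relation.Unary.Any using (here; there)
  open import Data.List.Relation.Unary.Unique.Propositional using (Unique; _∷_)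
  open import Data.List.Relation.Unary.Unique.Propositional.Properties using (filter⁺)
  open import Data.List.Relation.Unary.All.Properties using (¬Any⇒All¬; All¬⇒¬Any)
  open import Data.Product using (_×_; _,_; proj₁; proj₂)
  open import Function.Bundles using (_⇔_; mk⇔)
  open import Relation.Nullary using (Dec; yes; no; contradiction)
  open import Relation.Nullary.Decidable using (¬?)
  open import Relation.Unary using (Decidable)
  open import Relation.Binary.Definitions using (DecidableEquality)
  open import Relation.Binary.PropositionalEquality using (_≡_; _≢_; refl; sym; trans; cong; subst; module ≡-Reasoning)
  open import Function.Base using (case_of_)

  private variable A : Set

  length-unique-cong : {xs ys : List A} → Unique xs → Unique ys →
                       (∀ {x} → x ∈ xs ⇔ x ∈ ys) → length xs ≡ length ys
  length-unique-cong !xs !ys xs≈ys = ↭-length (∼bag⇒↭ (unique∧set⇒bag !xs !ys xs≈ys))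

  unique-head : ∀ {x} {xs : List A} → Unique (x ∷ xs) → x ∉ xs
  unique-head (x≢xs ∷ _) = All¬⇒¬Any x≢xs

  unique-tail : ∀ {x} {xs : List A} → Unique (x ∷ xs) → Unique xs
  unique-tail (_ ∷ !xs) = !xs

  unique-∷ : ∀ {x} {xs : List A} → x ∉ xs → Unique xs → Unique (x ∷ xs)
  unique-∷ x∉xs !xs = ¬Any⇒All¬ _ x∉xs ∷ !xs

  module Involution (_≟_ : DecidableEquality A) (σ : A → A) where

    isFixed? : Decidable (λ x → σ x ≡ x)
    isFixed? x = σ x ≟ x

    fixedPoints : List A → List A
    fixedPoints = filter isFixed?

    record IsInvolutionOn (xs : List A) : Set where
      field
        closed     : ∀ {x} → x ∈ xs → σ x ∈ xs
        involutive : ∀ {x} → x ∈ xs → σ (σ x) ≡ x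

    module _ {x : A} {xs : List A} (!x∷xs : Unique (x ∷ xs)) (inv : IsInvolutionOn (x ∷ xs)) where
      open IsInvolutionOn inv

      private
        x∉xs : x ∉ xs
        x∉xs = unique-head !x∷xs

      fixed-head-tail-involution : σ x ≡ x → IsInvolutionOn xs
      fixed-head-tail-involution σx≡x = record { closed = tail-closed ; involutive = λ y∈ → involutive (there y∈) }
        where
        tail-closed : ∀ {y} → y ∈ xs → σ y ∈ xs
        tail-closed {y} y∈ with closed (there y∈)
        ... | there σy∈ = σy∈
        ... | here σy≡x = contradiction (subst (_∈ xs) y≡x y∈) x∉xs
          where y≡x : y ≡ x
                y≡x = trans (sym (involutive (there y∈))) (trans (cong σ σy≡x) σx≡x)

      module RemoveOrbit (σx≢x : σ x ≢ x) where

        σx∈xs : σ x ∈ xs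
        σx∈xs with closed (here refl)
        ... | here σx≡x = contradiction σx≡x σx≢x
        ... | there σx∈ = σx∈

        ≢σx? : Decidable (_≢ σ x)
        ≢σx? y = ¬? (y ≟ σ x)

        rest : List A
        rest = filter ≢σx? xs

        ∈-rest⁻ : ∀ {y} → y ∈ rest → y ∈ xs × y ≢ σ x
        ∈-rest⁻ = ∈-filter⁻ ≢σx? {xs = xs}

        unique-rest : Unique rest
        unique-rest = filter⁺ ≢σx? (unique-tail !x∷xs)

        length-tail : length xs ≡ suc (length rest)
        length-tail = length-unique-cong (unique-tail !x∷xs) (unique-∷ σx∉rest unique-rest)
          (λ {y} → mk⇔ (λ y∈xs → case y ≟ σ x of λ where
                          (yes refl) → here refl
                          (no y≢σx)  → there (∈-filter⁺ ≢σx? y∈xs y≢σx))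
                       (λ where (here refl) → σx∈xs
                                (there y∈rest) → proj₁ (∈-rest⁻ y∈rest)))
          where σx∉rest : σ x ∉ rest
                σx∉rest σx∈rest = proj₂ (∈-rest⁻ σx∈rest) refl

        rest-involution : IsInvolutionOn rest
        rest-involution = record { closed = rest-closed ; involutive = λ y∈ → involutive (there (proj₁ (∈-rest⁻ y∈))) }
          where
          rest-closed : ∀ {y} → y ∈ rest → σ y ∈ rest
          rest-closed {y} y∈rest with ∈-rest⁻ y∈rest
          ... | y∈xs , y≢σx with closed (there y∈xs)
          ...   | here σy≡x = contradiction (trans (sym (involutive (there y∈xs))) (cong σ σy≡x)) y≢σx
          ...   | there σy∈xs = ∈-filter⁺ ≢σx? σy∈xs (λ σy≡σx → x∉xs (subst (_∈ xs) (y≡x σy≡σx) y∈xs))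
            where y≡x : σ y ≡ σ x → y ≡ x
                  y≡x σy≡σx = trans (sym (involutive (there y∈xs))) (trans (cong σ σy≡σx) (involutive (here refl)))

        length-fixedPoints-tail : length (fixedPoints xs) ≡ length (fixedPoints rest)
        length-fixedPoints-tail = length-unique-cong (filter⁺ isFixed? (unique-tail !x∷xs)) (filter⁺ isFixed? unique-rest)
          (mk⇔ (λ y∈ → let y∈xs , σy≡y = ∈-filter⁻ isFixed? {xs = xs} y∈ in
                  ∈-filter⁺ isFixed? (∈-filter⁺ ≢σx? y∈xs (λ { refl → σx≢x (sym (trans (sym (involutive (here refl))) σy≡y)) })) σy≡y)
               (λ y∈ → let y∈rest , σy≡y = ∈-filter⁻ isFixed? {xs = rest} y∈ in
                  ∈-filter⁺ isFixed? (proj₁ (∈-rest⁻ y∈rest)) σy≡y))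

    -- Non-fixed points come in pairs {x , σ x}.
    parity-length≡parity-fixedPoints : ∀ {xs} → Unique xs → IsInvolutionOn xs →
                                       parity (length xs) ≡ parity (length (fixedPoints xs))
    parity-length≡parity-fixedPoints {xs} = bounded (length xs) xs ≤-refl
      where
      -- recursion on a bound N, since rest is not a structural subterm of x ∷ xs
      bounded : ∀ N xs → length xs ≤ N → Unique xs → IsInvolutionOn xs →
                parity (length xs) ≡ parity (length (fixedPoints xs))
      bounded _ [] _ _ _ = refl
      bounded (suc N) (x ∷ xs) (s≤s |xs|≤N) !x∷xs inv = step (isFixed? x)
        where
        open ≡-Reasoning
        step : Dec (σ x ≡ x) → parity (length (x ∷ xs)) ≡ parity (length (fixedPoints (x ∷ xs)))
        step (yes σx≡x) = begin
          parity (suc (length xs))                 ≡⟨ parity-suc-cong (length xs) (length (fixedPoints xs)) (bounded N xs |xs|≤N (unique-tail !x∷xs)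
                                                        (fixed-head-tail-involution !x∷xs inv σx≡x)) ⟩
          parity (suc (length (fixedPoints xs)))   ≡⟨ cong (λ l → parity (length l)) (sym (filter-accept isFixed? σx≡x)) ⟩
          parity (length (fixedPoints (x ∷ xs)))   ∎
        step (no σx≢x) = begin
          parity (suc (length xs))                 ≡⟨ cong (λ l → parity (suc l)) length-tail ⟩
          parity (length rest)                     ≡⟨ bounded N rest |rest|≤N unique-rest rest-involution ⟩
          parity (length (fixedPoints rest))       ≡⟨ cong parity (sym length-fixedPoints-tail) ⟩
          parity (length (fixedPoints xs))         ≡⟨ cong (λ l → parity (length l)) (sym (filter-reject isFixed? σx≢x)) ⟩
          parity (length (fixedPoints (x ∷ xs)))   ∎
          where
          open RemoveOrbit !x∷xs inv σx≢x
          |rest|≤N : length rest ≤ N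
          |rest|≤N = ≤-trans (n≤1+n _) (≤-trans (≤-reflexive (sym length-tail)) |xs|≤N)

module Congruence where

  open import Data.Nat.Base as ℕ using (ℕ; zero; suc; NonZero; _%_; _/_; _<_)
  open import Data.Nat.Properties using (_≟_)
  open import Data.Nat.DivMod using (m≡m%n+[m/n]*n; [m+kn]%n≡m%n; m<n⇒m%n≡m)
  open import Data.Nat.Divisibility using (_∣_; divides; m%n≡0⇒n∣m; n∣m⇒m%n≡0)
  open import Data.Integer.Base using (ℤ; +_; -[1+_]; _+_; _*_; -_; _-_; 0ℤ; 1ℤ)
  open import Data.Integer.Properties using (pos-+; pos-*; +-injective)
  open import Data.Integer.Tactic.RingSolver using (solve-∀)
  open import Relation.Binary.Bundles using (Setoid)
  open import Relation.Binary.Structures using (IsEquivalence)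
  open import Relation.Nullary using (¬_; Dec; yes; no)
  open import Relation.Binary.PropositionalEquality using (_≡_; refl; sym; trans; cong; module ≡-Reasoning)

  infix 4 _≡[_]_

  record _≡[_]_ (x : ℤ) (m : ℕ) (y : ℤ) : Set where
    constructor congruent
    field
      quotient : ℤ
      equation : x ≡ y + quotient * + m

  module _ {m : ℕ} where

    ≡⇒≡-mod : ∀ {x y} → x ≡ y → x ≡[ m ] y
    ≡⇒≡-mod {x} refl = congruent 0ℤ (ring x (+ m))
      where ring : ∀ x M → x ≡ x + 0ℤ * M
            ring = solve-∀

    mod-refl : ∀ x → x ≡[ m ] x
    mod-refl x = ≡⇒≡-mod {x = x} refl

    mod-sym : ∀ {x y} → x ≡[ m ] y → y ≡[ m ] x
    mod-sym {y = y} (congruent k refl) = congruent (- k) (ring y k (+ m))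
      where ring : ∀ y k M → y ≡ (y + k * M) + (- k) * M
            ring = solve-∀

    mod-trans : ∀ {x y z} → x ≡[ m ] y → y ≡[ m ] z → x ≡[ m ] z
    mod-trans {z = z} (congruent k refl) (congruent l refl) = congruent (l + k) (ring z l k (+ m))
      where ring : ∀ z l k M → (z + l * M) + k * M ≡ z + (l + k) * M
            ring = solve-∀

    +-cong-mod : ∀ {a a' b b'} → a ≡[ m ] a' → b ≡[ m ] b' → a + b ≡[ m ] a' + b'
    +-cong-mod {a' = a'} {b' = b'} (congruent k refl) (congruent l refl) = congruent (k + l) (ring a' b' k l (+ m))
      where ring : ∀ a b k l M → (a + k * M) + (b + l * M) ≡ (a + b) + (k + l) * M
            ring = solve-∀

    +-congˡ-mod : ∀ a {b b'} → b ≡[ m ] b' → a + b ≡[ m ] a + b'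
    +-congˡ-mod a = +-cong-mod (mod-refl a)

    neg-cong-mod : ∀ {a a'} → a ≡[ m ] a' → - a ≡[ m ] - a'
    neg-cong-mod {a' = a'} (congruent k refl) = congruent (- k) (ring a' k (+ m))
      where ring : ∀ a k M → - (a + k * M) ≡ - a + (- k) * M
            ring = solve-∀

    *-congˡ-mod : ∀ c {a a'} → a ≡[ m ] a' → c * a ≡[ m ] c * a'
    *-congˡ-mod c {a' = a'} (congruent k refl) = congruent (c * k) (ring c a' k (+ m))
      where ring : ∀ c a k M → c * (a + k * M) ≡ c * a + (c * k) * M
            ring = solve-∀

    modulus≡0-mod : + m ≡[ m ] 0ℤ
    modulus≡0-mod = congruent 1ℤ (ring (+ m))
      where ring : ∀ M → M ≡ 0ℤ + 1ℤ * M
            ring = solve-∀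

    +-cancelʳ-mod : ∀ c {a b} → a + c ≡[ m ] b + c → a ≡[ m ] b
    +-cancelʳ-mod c {a} {b} (congruent k eq) =
      congruent k (trans (ring₁ a c) (trans (cong (_- c) eq) (ring₂ b c k (+ m))))
      where ring₁ : ∀ a c → a ≡ (a + c) - c
            ring₁ = solve-∀
            ring₂ : ∀ b c k M → ((b + c) + k * M) - c ≡ b + k * M
            ring₂ = solve-∀

    multiple≡0-mod : ∀ x → + m * x ≡[ m ] 0ℤ
    multiple≡0-mod x = congruent x (ring x (+ m))
      where ring : ∀ x M → M * x ≡ 0ℤ + x * M
            ring = solve-∀

    ≡0-mod⇒≡-mod : ∀ {x y} → x - y ≡[ m ] 0ℤ → x ≡[ m ] y
    ≡0-mod⇒≡-mod {x} {y} (congruent k eq) = congruent k (trans (ring₁ x y) (trans (cong (_+ y) eq) (ring₂ k (+ m) y)))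
      where ring₁ : ∀ x y → x ≡ (x - y) + y
            ring₁ = solve-∀
            ring₂ : ∀ k M y → (0ℤ + k * M) + y ≡ y + k * M
            ring₂ = solve-∀

    ≡-mod⇒-≡0-mod : ∀ {x y} → x ≡[ m ] y → x - y ≡[ m ] 0ℤ
    ≡-mod⇒-≡0-mod {y = y} (congruent k refl) = congruent k (ring y k (+ m))
      where ring : ∀ y k M → (y + k * M) - y ≡ 0ℤ + k * M
            ring = solve-∀

    ≡-mod-isEquivalence : IsEquivalence (λ x y → x ≡[ m ] y)
    ≡-mod-isEquivalence = record { refl = mod-refl _ ; sym = mod-sym ; trans = mod-trans }

  ≡-mod-setoid : ℕ → Setoid _ _
  ≡-mod-setoid m = record { isEquivalence = ≡-mod-isEquivalence {m} }

  ≡-mod-∣ : ∀ {m e x y} → e ∣ m → x ≡[ m ] y → x ≡[ e ] y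
  ≡-mod-∣ {e = e} {y = y} (divides q refl) (congruent k refl) =
    congruent (k * + q) (trans (cong (λ t → y + k * t) (pos-* q e)) (ring y k (+ q) (+ e)))
    where ring : ∀ y k q e → y + k * (q * e) ≡ y + (k * q) * e
          ring = solve-∀

  ≡-mod-1 : ∀ x y → x ≡[ 1 ] y
  ≡-mod-1 x y = congruent (x - y) (ring x y)
    where ring : ∀ x y → x ≡ y + (x - y) * 1ℤ
          ring = solve-∀

  module _ {m : ℕ} .{{_ : NonZero m}} where

    private
      +-division : ∀ a → + a ≡ + (a % m) + + (a / m) * + m
      +-division a = trans (cong +_ (m≡m%n+[m/n]*n a m))
                           (trans (pos-+ (a % m) _) (cong (λ t → + (a % m) + t) (pos-* (a / m) m)))

      +-multiple⇒%≡ : ∀ a b k → + a ≡ + b + + k * + m → a % m ≡ b % m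
      +-multiple⇒%≡ a b k eq = trans (cong (_% m) a≡b+km) ([m+kn]%n≡m%n b k m)
        where a≡b+km : a ≡ b ℕ.+ k ℕ.* m
              a≡b+km = +-injective (trans eq (sym (trans (pos-+ b (k ℕ.* m)) (cong (λ t → + b + t) (pos-* k m)))))

    %≡%⇒≡-mod : ∀ a b → a % m ≡ b % m → + a ≡[ m ] + b
    %≡%⇒≡-mod a b eq = congruent (+ (a / m) - + (b / m)) (begin
      + a                                           ≡⟨ +-division a ⟩
      + (a % m) + + (a / m) * + m                   ≡⟨ cong (λ r → + r + + (a / m) * + m) eq ⟩
      + (b % m) + + (a / m) * + m                   ≡⟨ ring (+ (b % m)) (+ (a / m)) (+ (b / m)) (+ m) ⟩
      (+ (b % m) + + (b / m) * + m) + (+ (a / m) - + (b / m)) * + m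
                                                    ≡⟨ cong (_+ (+ (a / m) - + (b / m)) * + m) (sym (+-division b)) ⟩
      + b + (+ (a / m) - + (b / m)) * + m           ∎)
      where open ≡-Reasoning
            ring : ∀ r q q' M → r + q * M ≡ (r + q' * M) + (q - q') * M
            ring = solve-∀

    ≡-mod⇒%≡% : ∀ a b → + a ≡[ m ] + b → a % m ≡ b % m
    ≡-mod⇒%≡% a b (congruent (+ k) eq) = +-multiple⇒%≡ a b k eq
    ≡-mod⇒%≡% a b (congruent -[1+ k ] eq) = sym (+-multiple⇒%≡ b a (suc k) (trans (ring (+ b) (+ suc k) (+ m))
      (cong (_+ + suc k * + m) (sym eq))))
      where ring : ∀ b k M → b ≡ (b + (- k) * M) + k * M
            ring = solve-∀

    ≡-mod? : ∀ a b → Dec (+ a ≡[ m ] + b)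
    ≡-mod? a b with a % m ≟ b % m
    ... | yes eq = yes (%≡%⇒≡-mod a b eq)
    ... | no neq = no (λ a≡b → neq (≡-mod⇒%≡% a b a≡b))

    ∣⇒≡0-mod : ∀ a → m ∣ a → + a ≡[ m ] 0ℤ
    ∣⇒≡0-mod a m∣a = %≡%⇒≡-mod a 0 (trans (n∣m⇒m%n≡0 a m m∣a) (sym (m<n⇒m%n≡m (ℕ.>-nonZero⁻¹ m))))

    ≡0-mod⇒∣ : ∀ a → + a ≡[ m ] 0ℤ → m ∣ a
    ≡0-mod⇒∣ a a≡0 = m%n≡0⇒n∣m a m (trans (≡-mod⇒%≡% a 0 a≡0) (m<n⇒m%n≡m (ℕ.>-nonZero⁻¹ m)))

    <⇒≡-mod⇒≡ : ∀ {a b} → a < m → b < m → + a ≡[ m ] + b → a ≡ b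
    <⇒≡-mod⇒≡ {a} {b} a<m b<m a≡b = trans (sym (m<n⇒m%n≡m a<m)) (trans (≡-mod⇒%≡% a b a≡b) (m<n⇒m%n≡m b<m))

    positive-<⇒≢0-mod : ∀ {a} → 0 < a → a < m → ¬ + a ≡[ m ] 0ℤ
    positive-<⇒≢0-mod {suc a} _ a<m a≡0 with <⇒≡-mod⇒≡ a<m (ℕ.>-nonZero⁻¹ m) a≡0
    ... | ()

  ≡-mod-dec : ∀ m a b → Dec (+ a ≡[ m ] + b)
  ≡-mod-dec zero a b with a ≟ b
  ... | yes refl = yes (≡⇒≡-mod refl)
  ... | no a≢b = no (λ { (congruent k eq) → a≢b (+-injective (trans eq (ring (+ b) k))) })
    where ring : ∀ b k → b + k * 0ℤ ≡ b
          ring = solve-∀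
  ≡-mod-dec (suc m) a b = ≡-mod? a b

  module ≡-mod-Reasoning (m : ℕ) where
    open import Relation.Binary.Reasoning.Setoid (≡-mod-setoid m) public

module NatSubsets where

  open import Data.Nat.Base using (ℕ; zero; suc; _+_; _*_; _≤_; _<_; z≤n; s≤s; NonZero; _%_; _/_; >-nonZero)
  open import Data.Nat.Properties using (≤-refl; ≤-pred; m≤n⇒m≤1+n; m≤n⇒m<n∨m≡n)
  open import Data.Nat.DivMod using (m≡m%n+[m/n]*n; m%n<n)
  open import Data.Nat.Divisibility using (_∣_; divides; m%n≡0⇒n∣m)
  open import Data.Sum using (_⊎_; inj₁; inj₂)
  open import Data.Product using (Σ; _×_; _,_)
  open import Relation.Nullary using (¬_; yes; no; contradiction)
  open import Relation.Unary using (Decidable)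
  open import Relation.Binary.PropositionalEquality using (_≡_; refl; subst)

  module _ {P : ℕ → Set} (P? : Decidable P) where

    LeastPositive : ℕ → Set
    LeastPositive e = 1 ≤ e × P e × (∀ k → 1 ≤ k → k < e → ¬ P k)

    private
      search : ∀ b → (Σ ℕ λ e → e ≤ b × LeastPositive e) ⊎ (∀ k → 1 ≤ k → k ≤ b → ¬ P k)
      search zero = inj₂ λ { _ () z≤n }
      search (suc b) with search b
      ... | inj₁ (e , e≤b , least) = inj₁ (e , m≤n⇒m≤1+n e≤b , least)
      ... | inj₂ none with P? (suc b)
      ...   | yes P[1+b] = inj₁ (suc b , ≤-refl , s≤s z≤n , P[1+b] , λ k 1≤k k<1+b → none k 1≤k (≤-pred k<1+b))
      ...   | no ¬P[1+b] = inj₂ λ k 1≤k k≤1+b → case k 1≤k (m≤n⇒m<n∨m≡n k≤1+b)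
        where case : ∀ k → 1 ≤ k → k < suc b ⊎ k ≡ suc b → ¬ P k
              case k 1≤k (inj₁ k<1+b) = none k 1≤k (≤-pred k<1+b)
              case _ _   (inj₂ refl)  = ¬P[1+b]

    least-positive : ∀ {m} → 1 ≤ m → P m → Σ ℕ LeastPositive
    least-positive {m} 1≤m Pm with search m
    ... | inj₁ (e , _ , least) = e , least
    ... | inj₂ none            = contradiction Pm (none m 1≤m ≤-refl)

  module AdditivelyClosed {P : ℕ → Set}
           (P0 : P 0) (P-+ : ∀ a b → P a → P b → P (a + b)) (P-∸ : ∀ a b → P (a + b) → P b → P a)
           {e} (1≤e : 1 ≤ e) (Pe : P e) (least : ∀ k → 1 ≤ k → k < e → ¬ P k) where

    private instance
      e-nonZero : NonZero e
      e-nonZero = >-nonZero 1≤e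

    P-multiple : ∀ q → P (q * e)
    P-multiple zero    = P0
    P-multiple (suc q) = P-+ e (q * e) Pe (P-multiple q)

    ∣⇒P : ∀ {a} → e ∣ a → P a
    ∣⇒P (divides q refl) = P-multiple q

    P⇒∣ : ∀ a → P a → e ∣ a
    P⇒∣ a Pa with a % e in a%e | P-∸ (a % e) (a / e * e) (subst P (m≡m%n+[m/n]*n a e) Pa) (P-multiple (a / e))
    ... | zero  | _       = m%n≡0⇒n∣m a e a%e
    ... | suc r | P[1+r] = contradiction P[1+r] (least (suc r) (s≤s z≤n) (subst (_< e) a%e (m%n<n a e)))

module Dihedral (n : ℕ) .{{_ : NonZero n}} where

  open Congruence
  open import Data.Nat.Base as ℕ using (_%_; _∸_)
  open import Data.Nat.Properties using (m∸n+n≡m; <⇒≤)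
  open import Data.Nat.DivMod using (_mod_; m%n%n≡m%n; m%n<n)
  open import Data.Fin.Base using (Fin; zero; suc; toℕ)
  open import Data.Fin.Properties using (toℕ<n; toℕ-fromℕ<; toℕ-injective)
  open import Data.Integer.Base using (ℤ; +_; _+_; _*_; -_; 0ℤ; 1ℤ; -1ℤ)
  open import Data.Integer.Properties using (pos-+; *-identityˡ; -1*i≡-i)
  open import Data.Integer.Tactic.RingSolver using (solve-∀)
  open import Data.Bool.Base using (Bool; true; false; _xor_)
  open import Data.Vec.Base using (Vec; []; _∷_; lookup; replicate; zipWith; map)
  open import Data.Product using (_,_; proj₂)
  open import Relation.Binary.PropositionalEquality using (_≡_; refl; sym; trans; cong; cong₂)

  -- Elements a^i b^s are compared through the exponent i, as an integer modulo n.
  exponent : Fin n → ℤ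
  exponent i = + toℕ i

  rotation : D n → ℤ
  rotation (i , _) = exponent i

  sign : Bool → ℤ
  sign false = 1ℤ
  sign true  = -1ℤ

  exponent-mod : ∀ a → exponent (a mod n) ≡[ n ] + a
  exponent-mod a rewrite toℕ-fromℕ< (m%n<n a n) = %≡%⇒≡-mod (a % n) a (m%n%n≡m%n a n)

  exponent-addm : ∀ i j → exponent (addm n i j) ≡[ n ] exponent i + exponent j
  exponent-addm i j = mod-trans (exponent-mod (toℕ i ℕ.+ toℕ j)) (≡⇒≡-mod (pos-+ (toℕ i) (toℕ j)))

  exponent-negm : ∀ i → exponent (negm n i) ≡[ n ] - exponent i
  exponent-negm i = mod-trans (exponent-mod (n ∸ toℕ i)) (congruent 1ℤ (begin
    + (n ∸ toℕ i)                          ≡⟨ ring (+ (n ∸ toℕ i)) (exponent i) ⟩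
    - exponent i + 1ℤ * (+ (n ∸ toℕ i) + exponent i)
                                           ≡⟨ cong (λ t → - exponent i + 1ℤ * t) (sym (pos-+ (n ∸ toℕ i) (toℕ i))) ⟩
    - exponent i + 1ℤ * + (n ∸ toℕ i ℕ.+ toℕ i)
                                           ≡⟨ cong (λ t → - exponent i + 1ℤ * + t) (m∸n+n≡m (<⇒≤ (toℕ<n i))) ⟩
    - exponent i + 1ℤ * + n                ∎))
    where open Relation.Binary.PropositionalEquality.≡-Reasoning
          ring : ∀ x a → x ≡ - a + 1ℤ * (x + a)
          ring = solve-∀

  exponent-injective-mod : ∀ {i j} → exponent i ≡[ n ] exponent j → i ≡ j
  exponent-injective-mod {i} {j} i≡j = toℕ-injective (<⇒≡-mod⇒≡ (toℕ<n i) (toℕ<n j) i≡j)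

  D-≡ : ∀ {x y : D n} → rotation x ≡[ n ] rotation y → proj₂ x ≡ proj₂ y → x ≡ y
  D-≡ {i , s} {j , .s} i≡j refl = cong (_, s) (exponent-injective-mod i≡j)

  rotation-one : rotation (one n) ≡[ n ] 0ℤ
  rotation-one = exponent-mod 0

  rotation-mul : ∀ x y → rotation (mul n x y) ≡[ n ] rotation x + sign (proj₂ x) * rotation y
  rotation-mul (i , false) (j , _) =
    mod-trans (exponent-addm i j) (≡⇒≡-mod (cong (_+_ (exponent i)) (sym (*-identityˡ (exponent j)))))
  rotation-mul (i , true) (j , _) =
    mod-trans (exponent-addm i (negm n j)) (mod-trans (+-congˡ-mod (exponent i) (exponent-negm j))
      (≡⇒≡-mod (cong (_+_ (exponent i)) (sym (-1*i≡-i (exponent j))))))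

  reflection-mul : ∀ x y → proj₂ (mul n x y) ≡ proj₂ x xor proj₂ y
  reflection-mul (_ , false) _ = refl
  reflection-mul (_ , true)  _ = refl

  rotation-inv : ∀ x → rotation (inv n x) ≡[ n ] (- sign (proj₂ x)) * rotation x
  rotation-inv (i , false) = mod-trans (exponent-negm i) (≡⇒≡-mod (sym (-1*i≡-i (exponent i))))
  rotation-inv (i , true)  = ≡⇒≡-mod (sym (*-identityˡ (exponent i)))

  reflection-inv : ∀ x → proj₂ (inv n x) ≡ proj₂ x
  reflection-inv (_ , false) = refl
  reflection-inv (_ , true)  = refl

  -- Identities between words in D n, decided by normalising each word to a^(Σ cⱼ xⱼ) b^s.
  infixl 7 _·_
  data Word (k : ℕ) : Set where
    rot ref : Fin k → Word k
    _·_     : Word k → Word k → Word k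
    _⁻¹     : Word k → Word k
    ε       : Word k

  reflectionBit : ∀ {k} → Word k → Bool
  reflectionBit (rot _) = false
  reflectionBit (ref _) = true
  reflectionBit (u · v) = reflectionBit u xor reflectionBit v
  reflectionBit (u ⁻¹)  = reflectionBit u
  reflectionBit ε       = false

  basis : ∀ {k} → Fin k → Vec ℤ k
  basis zero    = 1ℤ ∷ replicate _ 0ℤ
  basis (suc j) = 0ℤ ∷ basis j

  normalForm : ∀ {k} → Word k → Vec ℤ k
  normalForm (rot j) = basis j
  normalForm (ref j) = basis j
  normalForm (u · v) = zipWith _+_ (normalForm u) (map (sign (reflectionBit u) *_) (normalForm v))
  normalForm (u ⁻¹)  = map (- sign (reflectionBit u) *_) (normalForm u)
  normalForm ε       = replicate _ 0ℤ

  linear : ∀ {k} → Vec (Fin n) k → Vec ℤ k → ℤ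
  linear []        []       = 0ℤ
  linear (x ∷ env) (c ∷ cs) = c * exponent x + linear env cs

  linear-zipWith : ∀ {k} (env : Vec (Fin n) k) cs ds →
                   linear env (zipWith _+_ cs ds) ≡ linear env cs + linear env ds
  linear-zipWith []        []       []       = refl
  linear-zipWith (x ∷ env) (c ∷ cs) (d ∷ ds) =
    trans (cong (_+_ ((c + d) * exponent x)) (linear-zipWith env cs ds)) (ring c d (exponent x) (linear env cs) (linear env ds))
    where ring : ∀ c d x s t → (c + d) * x + (s + t) ≡ (c * x + s) + (d * x + t)
          ring = solve-∀

  linear-map : ∀ {k} (env : Vec (Fin n) k) a cs → linear env (map (a *_) cs) ≡ a * linear env cs
  linear-map []        a []       = ring a
    where ring : ∀ a → 0ℤ ≡ a * 0ℤ
          ring = solve-∀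
  linear-map (x ∷ env) a (c ∷ cs) =
    trans (cong (_+_ ((a * c) * exponent x)) (linear-map env a cs)) (ring a c (exponent x) (linear env cs))
    where ring : ∀ a c x s → (a * c) * x + a * s ≡ a * (c * x + s)
          ring = solve-∀

  linear-replicate : ∀ {k} (env : Vec (Fin n) k) → linear env (replicate k 0ℤ) ≡ 0ℤ
  linear-replicate []        = refl
  linear-replicate (x ∷ env) = trans (cong (_+_ (0ℤ * exponent x)) (linear-replicate env)) (ring (exponent x))
    where ring : ∀ x → 0ℤ * x + 0ℤ ≡ 0ℤ
          ring = solve-∀

  linear-basis : ∀ {k} (env : Vec (Fin n) k) j → linear env (basis j) ≡ exponent (lookup env j)
  linear-basis (x ∷ env) zero    = trans (cong (_+_ (1ℤ * exponent x)) (linear-replicate env)) (ring (exponent x))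
    where ring : ∀ x → 1ℤ * x + 0ℤ ≡ x
          ring = solve-∀
  linear-basis (x ∷ env) (suc j) = trans (ring (exponent x) (linear env (basis j))) (linear-basis env j)
    where ring : ∀ x s → 0ℤ * x + s ≡ s
          ring = solve-∀

  module _ {k : ℕ} (env : Vec (Fin n) k) where

    ⟦_⟧ : Word k → D n
    ⟦ rot j ⟧ = (lookup env j , false)
    ⟦ ref j ⟧ = (lookup env j , true)
    ⟦ u · v ⟧ = mul n ⟦ u ⟧ ⟦ v ⟧
    ⟦ u ⁻¹ ⟧  = inv n ⟦ u ⟧
    ⟦ ε ⟧     = one n

    reflectionBit-sound : ∀ w → proj₂ ⟦ w ⟧ ≡ reflectionBit w
    reflectionBit-sound (rot _) = refl
    reflectionBit-sound (ref _) = refl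
    reflectionBit-sound (u · v) =
      trans (reflection-mul ⟦ u ⟧ ⟦ v ⟧) (cong₂ _xor_ (reflectionBit-sound u) (reflectionBit-sound v))
    reflectionBit-sound (u ⁻¹)  = trans (reflection-inv ⟦ u ⟧) (reflectionBit-sound u)
    reflectionBit-sound ε       = refl

    normalForm-sound : ∀ w → rotation ⟦ w ⟧ ≡[ n ] linear env (normalForm w)
    normalForm-sound (rot j) = ≡⇒≡-mod (sym (linear-basis env j))
    normalForm-sound (ref j) = ≡⇒≡-mod (sym (linear-basis env j))
    normalForm-sound (u · v) = begin
      rotation (mul n ⟦ u ⟧ ⟦ v ⟧)                         ≈⟨ rotation-mul ⟦ u ⟧ ⟦ v ⟧ ⟩
      rotation ⟦ u ⟧ + sign (proj₂ ⟦ u ⟧) * rotation ⟦ v ⟧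
        ≈⟨ +-cong-mod (normalForm-sound u)
             (≡⇒≡-mod (cong (λ s → sign s * rotation ⟦ v ⟧) (reflectionBit-sound u))) ⟩
      linear env (normalForm u) + sign (reflectionBit u) * rotation ⟦ v ⟧
        ≈⟨ +-congˡ-mod (linear env (normalForm u)) (*-congˡ-mod (sign (reflectionBit u)) (normalForm-sound v)) ⟩
      linear env (normalForm u) + sign (reflectionBit u) * linear env (normalForm v)
        ≡⟨ sym (trans (linear-zipWith env (normalForm u) _)
                      (cong (_+_ (linear env (normalForm u))) (linear-map env (sign (reflectionBit u)) (normalForm v)))) ⟩
      linear env (normalForm (u · v))                      ∎
      where open ≡-mod-Reasoning n
    normalForm-sound (u ⁻¹) = begin
      rotation (inv n ⟦ u ⟧)                               ≈⟨ rotation-inv ⟦ u ⟧ ⟩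
      (- sign (proj₂ ⟦ u ⟧)) * rotation ⟦ u ⟧              ≡⟨ cong (λ s → (- sign s) * rotation ⟦ u ⟧) (reflectionBit-sound u) ⟩
      (- sign (reflectionBit u)) * rotation ⟦ u ⟧          ≈⟨ *-congˡ-mod (- sign (reflectionBit u)) (normalForm-sound u) ⟩
      (- sign (reflectionBit u)) * linear env (normalForm u) ≡⟨ sym (linear-map env (- sign (reflectionBit u)) (normalForm u)) ⟩
      linear env (normalForm (u ⁻¹))                       ∎
      where open ≡-mod-Reasoning n
    normalForm-sound ε = mod-trans rotation-one (≡⇒≡-mod (sym (linear-replicate env)))

    solve : ∀ u v → normalForm u ≡ normalForm v → reflectionBit u ≡ reflectionBit v → ⟦ u ⟧ ≡ ⟦ v ⟧
    solve u v nf≡ bit≡ = D-≡ (mod-trans (normalForm-sound u) (mod-trans (≡⇒≡-mod (cong (linear env) nf≡)) (mod-sym (normalForm-sound v))))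
                             (trans (reflectionBit-sound u) (trans bit≡ (sym (reflectionBit-sound v))))

  a^_ : ℕ → D n
  a^ k = (k mod n , false)

  a^-+ : ∀ x y → mul n (a^ x) (a^ y) ≡ a^ (x ℕ.+ y)
  a^-+ x y = D-≡ (begin
    rotation (mul n (a^ x) (a^ y))                   ≈⟨ rotation-mul (a^ x) (a^ y) ⟩
    exponent (x mod n) + 1ℤ * exponent (y mod n)     ≈⟨ +-cong-mod (exponent-mod x) (*-congˡ-mod 1ℤ (exponent-mod y)) ⟩
    + x + 1ℤ * + y                                   ≡⟨ trans (cong (_+_ (+ x)) (*-identityˡ (+ y))) (sym (pos-+ x y)) ⟩
    + (x ℕ.+ y)                                      ≈⟨ mod-sym (exponent-mod (x ℕ.+ y)) ⟩
    rotation (a^ (x ℕ.+ y))                          ∎) refl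
    where open ≡-mod-Reasoning n

  a^-∸ : ∀ x y → mul n (a^ (x ℕ.+ y)) (inv n (a^ y)) ≡ a^ x
  a^-∸ x y = D-≡ (begin
    rotation (mul n (a^ (x ℕ.+ y)) (inv n (a^ y)))          ≈⟨ rotation-mul (a^ (x ℕ.+ y)) (inv n (a^ y)) ⟩
    exponent ((x ℕ.+ y) mod n) + 1ℤ * exponent (negm n (y mod n))
      ≈⟨ +-cong-mod (exponent-mod (x ℕ.+ y)) (*-congˡ-mod 1ℤ (mod-trans (exponent-negm (y mod n)) (neg-cong-mod (exponent-mod y)))) ⟩
    + (x ℕ.+ y) + 1ℤ * - + y                                ≡⟨ cong (_+ 1ℤ * - + y) (pos-+ x y) ⟩
    + x + + y + 1ℤ * - + y                                  ≡⟨ ring (+ x) (+ y) ⟩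
    + x                                                     ≈⟨ mod-sym (exponent-mod x) ⟩
    rotation (a^ x)                                         ∎) refl
    where open ≡-mod-Reasoning n
          ring : ∀ x y → x + y + 1ℤ * - y ≡ x
          ring = solve-∀

  a^-toℕ : ∀ r → (r , false) ≡ a^ (toℕ r)
  a^-toℕ r = D-≡ (mod-sym (exponent-mod (toℕ r))) refl

  a^n≡one : a^ n ≡ one n
  a^n≡one = D-≡ (mod-trans (exponent-mod n) (mod-trans modulus≡0-mod (mod-sym rotation-one))) refl

module Subgroups (n : ℕ) .{{_ : NonZero n}} where

  open Dihedral n
  import Data.Nat.Base as ℕ
  open import Data.Fin using (Fin; join; splitAt; #_)
  open import Data.Fin.Properties using (splitAt-join; join-splitAt; any?)
  open import Data.Fin.Subset using (_∈_)
  open import Data.Fin.Subset.Properties using (⊆-antisym; _∈?_)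
  open import Data.Vec.Base using ([]; _∷_; tabulate)
  open import Data.Vec.Properties using ([]=⇒lookup; lookup⇒[]=; lookup∘tabulate)
  open import Data.Bool.Base using (true; false)
  open import Data.Sum using (inj₁; inj₂; [_,_]′)
  open import Data.Product using (∃; _,_; proj₁; proj₂)
  open import Relation.Nullary using (¬_; Dec; yes; no; does; contradiction)
  open import Relation.Nullary.Decidable using (dec-true)
  open import Relation.Binary.PropositionalEquality using (_≡_; refl; sym; trans; cong; cong₂; subst)

  decode : Fin (n ℕ.+ n) → D n
  decode f = [ (λ i → (i , false)) , (λ i → (i , true)) ]′ (splitAt n f)

  decode-code : ∀ x → decode (code n x) ≡ x
  decode-code (i , false) rewrite splitAt-join n n (inj₁ i) = refl
  decode-code (i , true)  rewrite splitAt-join n n (inj₂ i) = refl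

  code-decode : ∀ f → code n (decode f) ≡ f
  code-decode f with splitAt n f in eq
  ... | inj₁ _ = trans (cong (join n n) (sym eq)) (join-splitAt n n f)
  ... | inj₂ _ = trans (cong (join n n) (sym eq)) (join-splitAt n n f)

  infix 4 _∈ₛ_ _∈ₛ?_
  _∈ₛ_ : D n → Sub n → Set
  x ∈ₛ K = _∈D_ n x K

  ∈-resp-≡ : ∀ {x y K} → x ≡ y → x ∈ₛ K → y ∈ₛ K
  ∈-resp-≡ refl x∈K = x∈K

  _∈ₛ?_ : ∀ x K → Dec (x ∈ₛ K)
  x ∈ₛ? K = code n x ∈? K

  subset : (P : D n → Set) → (∀ x → Dec (P x)) → Sub n
  subset P P? = tabulate (λ f → does (P? (decode f)))

  module _ {P : D n → Set} (P? : ∀ x → Dec (P x)) where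

    private
      does-true : ∀ {A : Set} (a? : Dec A) → does a? ≡ true → A
      does-true (yes a) _ = a

    ∈-subset⁻ : ∀ x → x ∈ₛ subset P P? → P x
    ∈-subset⁻ x x∈ = subst P (decode-code x)
      (does-true (P? (decode (code n x))) (trans (sym (lookup∘tabulate _ (code n x))) ([]=⇒lookup x∈)))

    ∈-subset⁺ : ∀ x → P x → x ∈ₛ subset P P?
    ∈-subset⁺ x px = lookup⇒[]= (code n x) _ (trans (lookup∘tabulate _ (code n x))
      (dec-true (P? (decode (code n x))) (subst P (sym (decode-code x)) px)))

  Sub-ext : ∀ {A B : Sub n} → (∀ x → x ∈ₛ A → x ∈ₛ B) → (∀ x → x ∈ₛ B → x ∈ₛ A) → A ≡ B
  Sub-ext {A} {B} A⊆B B⊆A = ⊆-antisym (transport A⊆B) (transport B⊆A)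
    where
    transport : ∀ {X Y : Sub n} → (∀ x → x ∈ₛ X → x ∈ₛ Y) → ∀ {f} → f ∈ X → f ∈ Y
    transport {X} {Y} X⊆Y {f} f∈X =
      subst (_∈ Y) (code-decode f) (X⊆Y (decode f) (subst (_∈ X) (sym (code-decode f)) f∈X))

  module _ {K : Sub n} (K≤G : IsSubgroup n K) where

    one∈ : one n ∈ₛ K
    one∈ = proj₁ K≤G

    mul∈ : ∀ x y → x ∈ₛ K → y ∈ₛ K → mul n x y ∈ₛ K
    mul∈ = proj₁ (proj₂ K≤G)

    inv∈ : ∀ x → x ∈ₛ K → inv n x ∈ₛ K
    inv∈ = proj₂ (proj₂ K≤G)

  rotation-conjugate-∈ : ∀ {K} → IsSubgroup n K → ∀ r → (r , false) ∈ₛ K → ∀ g → mul n (mul n g (r , false)) (inv n g) ∈ₛ K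
  rotation-conjugate-∈ K≤G r r∈K (a , false) =
    ∈-resp-≡ (solve (a ∷ r ∷ []) (rot (# 1)) ((rot (# 0) · rot (# 1)) · rot (# 0) ⁻¹) refl refl) r∈K
  rotation-conjugate-∈ K≤G r r∈K (a , true) =
    ∈-resp-≡ (solve (a ∷ r ∷ []) (rot (# 1) ⁻¹) ((ref (# 0) · rot (# 1)) · ref (# 0) ⁻¹) refl refl) (inv∈ K≤G (r , false) r∈K)

  rotations-normal : ∀ {K} → IsSubgroup n K → (∀ j → ¬ (j , true) ∈ₛ K) → IsNormal n K
  rotations-normal K≤G no-ref g (r , false) r∈K = rotation-conjugate-∈ K≤G r r∈K g
  rotations-normal K≤G no-ref g (r , true)  r∈K = contradiction r∈K (no-ref r)

  vertex-has-reflection : ∀ {K} → IsVertex n K → ∃ λ j → (j , true) ∈ₛ K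
  vertex-has-reflection {K} (K≤G , _ , not-normal) with any? (λ j → (j , true) ∈ₛ? K)
  ... | yes found = found
  ... | no none   = contradiction (rotations-normal K≤G (λ j j∈K → none (j , j∈K))) not-normal

  inv-involutive : ∀ x → inv n (inv n x) ≡ x
  inv-involutive (i , false) = solve (i ∷ []) (rot (# 0) ⁻¹ ⁻¹) (rot (# 0)) refl refl
  inv-involutive (i , true)  = solve (i ∷ []) (ref (# 0) ⁻¹ ⁻¹) (ref (# 0)) refl refl

  inv-mul : ∀ x y → inv n (mul n x y) ≡ mul n (inv n y) (inv n x)
  inv-mul (i , false) (j , false) = solve (i ∷ j ∷ []) ((rot (# 0) · rot (# 1)) ⁻¹) (rot (# 1) ⁻¹ · rot (# 0) ⁻¹) refl refl
  inv-mul (i , false) (j , true)  = solve (i ∷ j ∷ []) ((rot (# 0) · ref (# 1)) ⁻¹) (ref (# 1) ⁻¹ · rot (# 0) ⁻¹) refl refl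
  inv-mul (i , true)  (j , false) = solve (i ∷ j ∷ []) ((ref (# 0) · rot (# 1)) ⁻¹) (rot (# 1) ⁻¹ · ref (# 0) ⁻¹) refl refl
  inv-mul (i , true)  (j , true)  = solve (i ∷ j ∷ []) ((ref (# 0) · ref (# 1)) ⁻¹) (ref (# 1) ⁻¹ · ref (# 0) ⁻¹) refl refl

  -- KH = (H⁻¹K⁻¹)⁻¹ ⊆ (K H)⁻¹ = HK
  ProdSub-sym : ∀ {H K} → IsSubgroup n H → IsSubgroup n K → ProdSub n H K → ProdSub n K H
  ProdSub-sym {H} {K} H≤G K≤G HK⊆KH k h k∈K h∈H
    with HK⊆KH (inv n h) (inv n k) (inv∈ H≤G h h∈H) (inv∈ K≤G k k∈K)
  ... | k' , h' , k'∈K , h'∈H , eq = inv n h' , inv n k' , inv∈ H≤G h' h'∈H , inv∈ K≤G k' k'∈K , (begin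
    mul n k h                                   ≡⟨ cong₂ (mul n) (sym (inv-involutive k)) (sym (inv-involutive h)) ⟩
    mul n (inv n (inv n k)) (inv n (inv n h))   ≡⟨ sym (inv-mul (inv n h) (inv n k)) ⟩
    inv n (mul n (inv n h) (inv n k))           ≡⟨ cong (inv n) eq ⟩
    inv n (mul n k' h')                         ≡⟨ inv-mul k' h' ⟩
    mul n (inv n h') (inv n k')                 ∎)
    where open Relation.Binary.PropositionalEquality.≡-Reasoning

  ProdSub⇒Permute : ∀ {H K} → IsSubgroup n H → IsSubgroup n K → ProdSub n H K → Permute n H K
  ProdSub⇒Permute H≤G K≤G HK⊆KH = HK⊆KH , ProdSub-sym H≤G K≤G HK⊆KH

module ReflectionConjugation (n : ℕ) .{{_ : NonZero n}} (i : Fin n) where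

  open Dihedral n
  open Subgroups n
  open import Data.Fin using (#_)
  open import Data.Vec.Base using ([]; _∷_)
  open import Data.Bool.Base using (true; false)
  open import Data.Product using (_,_; proj₁)
  open import Relation.Nullary using (¬_)
  open import Relation.Binary.PropositionalEquality using (_≡_; _≢_; refl; sym; trans; cong; cong₂; subst; module ≡-Reasoning)

  τ : D n
  τ = (i , true)

  conjugate : D n → D n
  conjugate x = mul n (mul n τ x) τ

  conjugate-involutive : ∀ x → conjugate (conjugate x) ≡ x
  conjugate-involutive (j , false) = solve (i ∷ j ∷ []) ((ref (# 0) · ((ref (# 0) · rot (# 1)) · ref (# 0))) · ref (# 0)) (rot (# 1)) refl refl
  conjugate-involutive (j , true)  = solve (i ∷ j ∷ []) ((ref (# 0) · ((ref (# 0) · ref (# 1)) · ref (# 0))) · ref (# 0)) (ref (# 1)) refl refl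

  conjugate-one : conjugate (one n) ≡ one n
  conjugate-one = solve (i ∷ []) ((ref (# 0) · ε) · ref (# 0)) ε refl refl

  conjugate-mul : ∀ x y → conjugate (mul n x y) ≡ mul n (conjugate x) (conjugate y)
  conjugate-mul (j , false) (l , false) = solve (i ∷ j ∷ l ∷ []) ((ref (# 0) · (rot (# 1) · rot (# 2))) · ref (# 0)) (((ref (# 0) · rot (# 1)) · ref (# 0)) · ((ref (# 0) · rot (# 2)) · ref (# 0))) refl refl
  conjugate-mul (j , false) (l , true)  = solve (i ∷ j ∷ l ∷ []) ((ref (# 0) · (rot (# 1) · ref (# 2))) · ref (# 0)) (((ref (# 0) · rot (# 1)) · ref (# 0)) · ((ref (# 0) · ref (# 2)) · ref (# 0))) refl refl
  conjugate-mul (j , true)  (l , false) = solve (i ∷ j ∷ l ∷ []) ((ref (# 0) · (ref (# 1) · rot (# 2))) · ref (# 0)) (((ref (# 0) · ref (# 1)) · ref (# 0)) · ((ref (# 0) · rot (# 2)) · ref (# 0))) refl refl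
  conjugate-mul (j , true)  (l , true)  = solve (i ∷ j ∷ l ∷ []) ((ref (# 0) · (ref (# 1) · ref (# 2))) · ref (# 0)) (((ref (# 0) · ref (# 1)) · ref (# 0)) · ((ref (# 0) · ref (# 2)) · ref (# 0))) refl refl

  conjugate-inv : ∀ x → conjugate (inv n x) ≡ inv n (conjugate x)
  conjugate-inv (j , false) = solve (i ∷ j ∷ []) ((ref (# 0) · rot (# 1) ⁻¹) · ref (# 0)) (((ref (# 0) · rot (# 1)) · ref (# 0)) ⁻¹) refl refl
  conjugate-inv (j , true)  = solve (i ∷ j ∷ []) ((ref (# 0) · ref (# 1) ⁻¹) · ref (# 0)) (((ref (# 0) · ref (# 1)) · ref (# 0)) ⁻¹) refl refl

  conjugate-mul-swap : ∀ x y → mul n x y ≡ conjugate (mul n (conjugate x) (conjugate y))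
  conjugate-mul-swap x y = sym (trans (conjugate-mul (conjugate x) (conjugate y))
                                      (cong₂ (mul n) (conjugate-involutive x) (conjugate-involutive y)))

  conjugateSub : Sub n → Sub n
  conjugateSub K = subset (λ x → conjugate x ∈ₛ K) (λ x → conjugate x ∈ₛ? K)

  ∈-conjugateSub⁻ : ∀ {K} x → x ∈ₛ conjugateSub K → conjugate x ∈ₛ K
  ∈-conjugateSub⁻ {K} = ∈-subset⁻ (λ x → conjugate x ∈ₛ? K)

  ∈-conjugateSub⁺ : ∀ {K} x → conjugate x ∈ₛ K → x ∈ₛ conjugateSub K
  ∈-conjugateSub⁺ {K} = ∈-subset⁺ (λ x → conjugate x ∈ₛ? K)

  conjugate-∈-conjugateSub : ∀ {K} x → x ∈ₛ K → conjugate x ∈ₛ conjugateSub K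
  conjugate-∈-conjugateSub x x∈K = ∈-conjugateSub⁺ (conjugate x) (∈-resp-≡ (sym (conjugate-involutive x)) x∈K)

  conjugateSub-involutive : ∀ K → conjugateSub (conjugateSub K) ≡ K
  conjugateSub-involutive K = Sub-ext
    (λ x x∈ → ∈-resp-≡ (conjugate-involutive x) (∈-conjugateSub⁻ (conjugate x) (∈-conjugateSub⁻ x x∈)))
    (λ x x∈K → ∈-conjugateSub⁺ x (conjugate-∈-conjugateSub x x∈K))

  conjugateSub-subgroup : ∀ {K} → IsSubgroup n K → IsSubgroup n (conjugateSub K)
  conjugateSub-subgroup K≤G =
      ∈-conjugateSub⁺ (one n) (∈-resp-≡ (sym conjugate-one) (one∈ K≤G))
    , (λ x y x∈ y∈ → ∈-conjugateSub⁺ (mul n x y) (∈-resp-≡ (sym (conjugate-mul x y))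
         (mul∈ K≤G (conjugate x) (conjugate y) (∈-conjugateSub⁻ x x∈) (∈-conjugateSub⁻ y y∈))))
    , (λ x x∈ → ∈-conjugateSub⁺ (inv n x) (∈-resp-≡ (sym (conjugate-inv x))
         (inv∈ K≤G (conjugate x) (∈-conjugateSub⁻ x x∈))))

  conjugateSub-vertex : ∀ {K} → IsVertex n K → IsVertex n (conjugateSub K)
  conjugateSub-vertex {K} (K≤G , (y , y∉K) , K-not-normal) =
    conjugateSub-subgroup K≤G , (conjugate y , cy∉) , not-normal
    where
    cy∉ : ¬ conjugate y ∈ₛ conjugateSub K
    cy∉ cy∈ = y∉K (∈-resp-≡ (conjugate-involutive y) (∈-conjugateSub⁻ (conjugate y) cy∈))
    not-normal : ¬ IsNormal n (conjugateSub K)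
    not-normal normal = K-not-normal λ g k k∈K →
      ∈-resp-≡ (conjugated g k)
        (∈-conjugateSub⁻ (mul n (mul n (conjugate g) (conjugate k)) (inv n (conjugate g))) (normal (conjugate g) (conjugate k) (conjugate-∈-conjugateSub k k∈K)))
      where
      open ≡-Reasoning
      conjugated : ∀ g k → conjugate (mul n (mul n (conjugate g) (conjugate k)) (inv n (conjugate g)))
                           ≡ mul n (mul n g k) (inv n g)
      conjugated g k = begin
        conjugate (mul n (mul n (conjugate g) (conjugate k)) (inv n (conjugate g)))
          ≡⟨ conjugate-mul _ _ ⟩
        mul n (conjugate (mul n (conjugate g) (conjugate k))) (conjugate (inv n (conjugate g)))
          ≡⟨ cong₂ (mul n) (conjugate-mul (conjugate g) (conjugate k)) (conjugate-inv (conjugate g)) ⟩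
        mul n (mul n (conjugate (conjugate g)) (conjugate (conjugate k))) (inv n (conjugate (conjugate g)))
          ≡⟨ cong₂ (mul n) (cong₂ (mul n) (conjugate-involutive g) (conjugate-involutive k))
                           (cong (inv n) (conjugate-involutive g)) ⟩
        mul n (mul n g k) (inv n g) ∎

  module _ {H : Sub n} (H≤G : IsSubgroup n H) (τ∈H : τ ∈ₛ H) where

    conjugate-∈ : ∀ x → x ∈ₛ H → conjugate x ∈ₛ H
    conjugate-∈ x x∈H = mul∈ H≤G (mul n τ x) τ (mul∈ H≤G τ x τ∈H x∈H) τ∈H

    conjugateSub-fixes : conjugateSub H ≡ H
    conjugateSub-fixes = Sub-ext
      (λ x x∈ → ∈-resp-≡ (conjugate-involutive x) (conjugate-∈ (conjugate x) (∈-conjugateSub⁻ x x∈)))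
      (λ x x∈H → ∈-conjugateSub⁺ x (conjugate-∈ x x∈H))

    conjugateSub-permute : ∀ {K} → IsSubgroup n K → Permute n H K → Permute n H (conjugateSub K)
    conjugateSub-permute {K} K≤G (HK⊆KH , _) = ProdSub⇒Permute H≤G (conjugateSub-subgroup K≤G) HK'⊆K'H
      where
      HK'⊆K'H : ProdSub n H (conjugateSub K)
      HK'⊆K'H x k x∈H k∈ with HK⊆KH (conjugate x) (conjugate k) (conjugate-∈ x x∈H) (∈-conjugateSub⁻ k k∈)
      ... | k' , x' , k'∈K , x'∈H , eq = conjugate k' , conjugate x' , conjugate-∈-conjugateSub k' k'∈K , conjugate-∈ x' x'∈H ,
            trans (conjugate-mul-swap x k) (trans (cong conjugate eq) (conjugate-mul k' x'))

    conjugateSub-adjacent : ∀ {K} → Adjacent n H K → Adjacent n H (conjugateSub K)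
    conjugateSub-adjacent {K} (K-vertex , H≢K , H∼K) =
      conjugateSub-vertex K-vertex , H≢K' , conjugateSub-permute (proj₁ K-vertex) H∼K
      where
      H≢K' : H ≢ conjugateSub K
      H≢K' H≡K' = H≢K (trans (sym conjugateSub-fixes) (trans (cong conjugateSub H≡K') (conjugateSub-involutive K)))

    τ-invariant-permute : ∀ {K} → IsSubgroup n K → conjugateSub K ≡ K → Permute n H K
    τ-invariant-permute {K} K≤G K'≡K = ProdSub⇒Permute H≤G K≤G HK⊆KH
      where
      conjugate-∈K : ∀ k → k ∈ₛ K → conjugate k ∈ₛ K
      conjugate-∈K k k∈K = ∈-conjugateSub⁻ k (subst (k ∈ₛ_) (sym K'≡K) k∈K)
      HK⊆KH : ProdSub n H K
      HK⊆KH (r , false) (j , false) x∈H k∈K = (j , false) , (r , false) , k∈K , x∈H ,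
        solve (r ∷ j ∷ []) (rot (# 0) · rot (# 1)) (rot (# 1) · rot (# 0)) refl refl
      HK⊆KH (r , false) (j , true) x∈H k∈K = (j , true) , inv n (r , false) , k∈K , inv∈ H≤G (r , false) x∈H ,
        solve (r ∷ j ∷ []) (rot (# 0) · ref (# 1)) (ref (# 1) · rot (# 0) ⁻¹) refl refl
      HK⊆KH (r , true) (j , false) x∈H k∈K = conjugate (j , false) , (r , true) , conjugate-∈K (j , false) k∈K , x∈H ,
        solve (i ∷ r ∷ j ∷ []) (ref (# 1) · rot (# 2)) (((ref (# 0) · rot (# 2)) · ref (# 0)) · ref (# 1)) refl refl
      HK⊆KH (r , true) (j , true) x∈H k∈K =
        conjugate (j , true) , mul n (inv n (mul n (r , true) τ)) τ , conjugate-∈K (j , true) k∈K ,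
        mul∈ H≤G (inv n (mul n (r , true) τ)) τ (inv∈ H≤G (mul n (r , true) τ) (mul∈ H≤G (r , true) τ x∈H τ∈H)) τ∈H ,
        solve (i ∷ r ∷ j ∷ []) (ref (# 1) · ref (# 2)) (((ref (# 0) · ref (# 2)) · ref (# 0)) · ((ref (# 1) · ref (# 0)) ⁻¹ · ref (# 0))) refl refl

module Classification (n : ℕ) .{{_ : NonZero n}} where

  open Congruence
  open NatSubsets
  open Dihedral n
  open Subgroups n
  open import Data.Nat.Base as ℕ using (suc; _≤_; z≤n; s≤s; >-nonZero; >-nonZero⁻¹)
  open import Data.Nat.Properties using (<-≤-trans)
  open import Data.Nat.DivMod using (_mod_)
  open import Data.Nat.Divisibility using (_∣_)
  open import Data.Fin using (Fin; toℕ; #_)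
  open import Data.Integer.Base using (+_; _+_; _*_; -_; _-_; 0ℤ; 1ℤ; -1ℤ)
  open import Data.Integer.Tactic.RingSolver using (solve-∀)
  open import Data.Vec.Base using ([]; _∷_)
  open import Data.Bool.Base using (true; false)
  open import Data.Product using (Σ; _×_; _,_; proj₁; proj₂)
  open import Relation.Nullary using (¬_; Dec; contradiction)
  open import Relation.Binary.PropositionalEquality using (_≡_; refl; sym; subst)

  -- subdihedral e j is ⟨ a^e , a^j b ⟩, the elements a^r with e ∣ r and a^l b with l ≡ j (mod e).
  InSubdihedral : ℕ → Fin n → D n → Set
  InSubdihedral e j (r , false) = exponent r ≡[ e ] 0ℤ
  InSubdihedral e j (l , true)  = exponent l ≡[ e ] exponent j

  inSubdihedral? : ∀ e j x → Dec (InSubdihedral e j x)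
  inSubdihedral? e j (r , false) = ≡-mod-dec e (toℕ r) 0
  inSubdihedral? e j (l , true)  = ≡-mod-dec e (toℕ l) (toℕ j)

  subdihedral : ℕ → Fin n → Sub n
  subdihedral e j = subset (InSubdihedral e j) (inSubdihedral? e j)

  module _ {e : ℕ} (e∣n : e ∣ n) where

    rotation-mul-mod : ∀ x y → rotation (mul n x y) ≡[ e ] rotation x + sign (proj₂ x) * rotation y
    rotation-mul-mod x y = ≡-mod-∣ e∣n (rotation-mul x y)

    normalForm-sound-mod : ∀ {k} env (w : Word k) → rotation (⟦ env ⟧ w) ≡[ e ] linear env (normalForm w)
    normalForm-sound-mod env w = ≡-mod-∣ e∣n (normalForm-sound env w)

  module _ {e : ℕ} {j : Fin n} where

    ∈-subdihedral⁻ : ∀ x → x ∈ₛ subdihedral e j → InSubdihedral e j x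
    ∈-subdihedral⁻ = ∈-subset⁻ (inSubdihedral? e j)

    ∈-subdihedral⁺ : ∀ x → InSubdihedral e j x → x ∈ₛ subdihedral e j
    ∈-subdihedral⁺ = ∈-subset⁺ (inSubdihedral? e j)

    module _ (e∣n : e ∣ n) where

      subdihedral-subgroup : IsSubgroup n (subdihedral e j)
      subdihedral-subgroup = ∈-subdihedral⁺ (one n) (≡-mod-∣ e∣n rotation-one) , closed-mul , closed-inv
        where
        in-mul : ∀ x y → InSubdihedral e j x → InSubdihedral e j y → InSubdihedral e j (mul n x y)
        in-mul (r , false) (s , false) r≡0 s≡0 =
          mod-trans (rotation-mul-mod e∣n (r , false) (s , false)) (+-cong-mod r≡0 (*-congˡ-mod 1ℤ s≡0))
        in-mul (r , false) (l , true) r≡0 l≡j =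
          mod-trans (rotation-mul-mod e∣n (r , false) (l , true))
            (mod-trans (+-cong-mod r≡0 (*-congˡ-mod 1ℤ l≡j)) (≡⇒≡-mod (ring (exponent j))))
          where ring : ∀ j → 0ℤ + 1ℤ * j ≡ j
                ring = solve-∀
        in-mul (l , true) (r , false) l≡j r≡0 =
          mod-trans (rotation-mul-mod e∣n (l , true) (r , false))
            (mod-trans (+-cong-mod l≡j (*-congˡ-mod -1ℤ r≡0)) (≡⇒≡-mod (ring (exponent j))))
          where ring : ∀ j → j + -1ℤ * 0ℤ ≡ j
                ring = solve-∀
        in-mul (l , true) (l' , true) l≡j l'≡j =
          mod-trans (rotation-mul-mod e∣n (l , true) (l' , true))
            (mod-trans (+-cong-mod l≡j (*-congˡ-mod -1ℤ l'≡j)) (≡⇒≡-mod (ring (exponent j))))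
          where ring : ∀ j → j + -1ℤ * j ≡ 0ℤ
                ring = solve-∀
        closed-mul : ∀ x y → x ∈ₛ subdihedral e j → y ∈ₛ subdihedral e j → mul n x y ∈ₛ subdihedral e j
        closed-mul x y x∈ y∈ = ∈-subdihedral⁺ (mul n x y) (in-mul x y (∈-subdihedral⁻ x x∈) (∈-subdihedral⁻ y y∈))
        closed-inv : ∀ x → x ∈ₛ subdihedral e j → inv n x ∈ₛ subdihedral e j
        closed-inv (r , false) r∈ = ∈-subdihedral⁺ (inv n (r , false))
          (mod-trans (≡-mod-∣ e∣n (rotation-inv (r , false))) (*-congˡ-mod -1ℤ (∈-subdihedral⁻ (r , false) r∈)))
        closed-inv (l , true) l∈ = l∈

      rotation-conjugate-by-a : let a = (1 mod n , false) in
        rotation (mul n (mul n a (j , true)) (inv n a)) ≡[ e ] + 2 + exponent j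
      rotation-conjugate-by-a = begin
        rotation (⟦ env ⟧ w)                                 ≈⟨ normalForm-sound-mod e∣n env w ⟩
        + 2 * exponent (1 mod n) + (+ 1 * exponent j + 0ℤ)   ≈⟨ +-cong-mod (*-congˡ-mod (+ 2) (≡-mod-∣ e∣n (exponent-mod 1)))
                                                                          (mod-refl (+ 1 * exponent j + 0ℤ)) ⟩
        + 2 * + 1 + (+ 1 * exponent j + 0ℤ)                  ≡⟨ ring (exponent j) ⟩
        + 2 + exponent j                                     ∎
        where
        open ≡-mod-Reasoning e
        env = 1 mod n ∷ j ∷ []
        w = (rot (# 0) · ref (# 1)) · rot (# 0) ⁻¹
        ring : ∀ y → + 2 * + 1 + (+ 1 * y + 0ℤ) ≡ + 2 + y
        ring = solve-∀

      subdihedral-vertex : 3 ≤ e → IsVertex n (subdihedral e j)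
      subdihedral-vertex 3≤e = subdihedral-subgroup , (a , a∉) , not-normal
        where
        instance _ = >-nonZero (<-≤-trans (s≤s z≤n) 3≤e)
        a : D n
        a = (1 mod n , false)
        a∉ : ¬ a ∈ₛ subdihedral e j
        a∉ a∈ = positive-<⇒≢0-mod (s≤s z≤n) (<-≤-trans (s≤s (s≤s z≤n)) 3≤e)
                  (mod-trans (mod-sym (≡-mod-∣ e∣n (exponent-mod 1))) (∈-subdihedral⁻ a a∈))
        not-normal : ¬ IsNormal n (subdihedral e j)
        not-normal normal = positive-<⇒≢0-mod (s≤s z≤n) 3≤e (+-cancelʳ-mod (exponent j) {+ 2} {0ℤ}
          (mod-trans (mod-sym rotation-conjugate-by-a) (mod-trans aja⁻¹∈ (≡⇒≡-mod (ring (exponent j))))))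
          where
          aja⁻¹∈ : rotation (mul n (mul n a (j , true)) (inv n a)) ≡[ e ] exponent j
          aja⁻¹∈ = ∈-subdihedral⁻ (mul n (mul n a (j , true)) (inv n a))
                     (normal a (j , true) (∈-subdihedral⁺ (j , true) (mod-refl (exponent j))))
          ring : ∀ y → y ≡ 0ℤ + y
          ring = solve-∀

  subdihedral-1-full : ∀ {j} x → x ∈ₛ subdihedral 1 j
  subdihedral-1-full {j} (r , false) = ∈-subdihedral⁺ (r , false) (≡-mod-1 (exponent r) 0ℤ)
  subdihedral-1-full {j} (l , true)  = ∈-subdihedral⁺ (l , true) (≡-mod-1 (exponent l) (exponent j))

  subdihedral-2-normal : ∀ {j} → 2 ∣ n → IsNormal n (subdihedral 2 j)
  subdihedral-2-normal {j} 2∣n g (r , false) r∈ = rotation-conjugate-∈ (subdihedral-subgroup 2∣n) r r∈ g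
  subdihedral-2-normal {j} 2∣n (a , false) (l , true) l∈ = ∈-subdihedral⁺ (⟦ env ⟧ w) (begin
    rotation (⟦ env ⟧ w)                               ≈⟨ normalForm-sound-mod 2∣n env w ⟩
    + 2 * exponent a + (+ 1 * exponent l + 0ℤ)        ≈⟨ +-cong-mod (multiple≡0-mod (exponent a))
                                                            (+-cong-mod (*-congˡ-mod (+ 1) (∈-subdihedral⁻ (l , true) l∈)) (mod-refl 0ℤ)) ⟩
    0ℤ + (+ 1 * exponent j + 0ℤ)                       ≡⟨ ring (exponent j) ⟩
    exponent j                                         ∎)
    where
    open ≡-mod-Reasoning 2
    env = a ∷ l ∷ []
    w = (rot (# 0) · ref (# 1)) · rot (# 0) ⁻¹
    ring : ∀ y → 0ℤ + (+ 1 * y + 0ℤ) ≡ y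
    ring = solve-∀
  subdihedral-2-normal {j} 2∣n (a , true) (l , true) l∈ = ∈-subdihedral⁺ (⟦ env ⟧ w) (begin
    rotation (⟦ env ⟧ w)                               ≈⟨ normalForm-sound-mod 2∣n env w ⟩
    + 2 * exponent a + (-1ℤ * exponent l + 0ℤ)        ≈⟨ +-cong-mod (multiple≡0-mod (exponent a))
                                                            (+-cong-mod (*-congˡ-mod -1ℤ (∈-subdihedral⁻ (l , true) l∈)) (mod-refl 0ℤ)) ⟩
    0ℤ + (-1ℤ * exponent j + 0ℤ)                       ≈⟨ congruent (- exponent j) (ring (exponent j)) ⟩
    exponent j                                         ∎)
    where
    open ≡-mod-Reasoning 2
    env = a ∷ l ∷ []
    w = (ref (# 0) · ref (# 1)) · ref (# 0) ⁻¹
    ring : ∀ y → 0ℤ + (-1ℤ * y + 0ℤ) ≡ y + (- y) * + 2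
    ring = solve-∀

  module SubgroupWithReflection {K : Sub n} (K≤G : IsSubgroup n K) {j : Fin n} (j∈K : (j , true) ∈ₛ K) where

    private
      P : ℕ → Set
      P x = a^ x ∈ₛ K

      P-+ : ∀ x y → P x → P y → P (x ℕ.+ y)
      P-+ x y Px Py = ∈-resp-≡ (a^-+ x y) (mul∈ K≤G (a^ x) (a^ y) Px Py)

      P-∸ : ∀ x y → P (x ℕ.+ y) → P y → P x
      P-∸ x y Px+y Py = ∈-resp-≡ (a^-∸ x y) (mul∈ K≤G (a^ (x ℕ.+ y)) (inv n (a^ y)) Px+y (inv∈ K≤G (a^ y) Py))

      Pn : P n
      Pn = ∈-resp-≡ (sym a^n≡one) (one∈ K≤G)

      least = least-positive (λ x → a^ x ∈ₛ? K) (>-nonZero⁻¹ n) Pn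

    -- K ∩ ⟨a⟩ = ⟨a^e⟩
    e : ℕ
    e = proj₁ least

    1≤e : 1 ≤ e
    1≤e = proj₁ (proj₂ least)

    private
      instance
        e-nonZero : NonZero e
        e-nonZero = >-nonZero 1≤e
      open AdditivelyClosed (one∈ K≤G) P-+ P-∸ 1≤e (proj₁ (proj₂ (proj₂ least))) (proj₂ (proj₂ (proj₂ least)))

    e∣n : e ∣ n
    e∣n = P⇒∣ n Pn

    rotation∈⇒ : ∀ r → (r , false) ∈ₛ K → exponent r ≡[ e ] 0ℤ
    rotation∈⇒ r r∈K = ∣⇒≡0-mod (toℕ r) (P⇒∣ (toℕ r) (∈-resp-≡ (a^-toℕ r) r∈K))

    rotation∈⇐ : ∀ r → exponent r ≡[ e ] 0ℤ → (r , false) ∈ₛ K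
    rotation∈⇐ r r≡0 = ∈-resp-≡ (sym (a^-toℕ r)) (∣⇒P (≡0-mod⇒∣ (toℕ r) r≡0))

    private
      jl : Fin n → D n
      jl l = mul n (j , true) (l , true)

      rotation-jl : ∀ l → rotation (jl l) ≡[ e ] exponent j - exponent l
      rotation-jl l = mod-trans (rotation-mul-mod e∣n (j , true) (l , true)) (≡⇒≡-mod (ring (exponent j) (exponent l)))
        where ring : ∀ x y → x + -1ℤ * y ≡ x - y
              ring = solve-∀

    reflection∈⇒ : ∀ l → (l , true) ∈ₛ K → exponent l ≡[ e ] exponent j
    reflection∈⇒ l l∈K = mod-sym (≡0-mod⇒≡-mod (mod-trans (mod-sym (rotation-jl l))
                           (rotation∈⇒ (proj₁ (jl l)) (mul∈ K≤G (j , true) (l , true) j∈K l∈K))))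

    reflection∈⇐ : ∀ l → exponent l ≡[ e ] exponent j → (l , true) ∈ₛ K
    reflection∈⇐ l l≡j = ∈-resp-≡ (solve (j ∷ l ∷ []) (ref (# 0) · (ref (# 0) · ref (# 1))) (ref (# 1)) refl refl)
      (mul∈ K≤G (j , true) (jl l) j∈K (rotation∈⇐ (proj₁ (jl l)) (mod-trans (rotation-jl l) (≡-mod⇒-≡0-mod (mod-sym l≡j)))))

    K≡subdihedral : K ≡ subdihedral e j
    K≡subdihedral = Sub-ext
      (λ where (r , false) r∈ → ∈-subdihedral⁺ (r , false) (rotation∈⇒ r r∈)
               (l , true)  l∈ → ∈-subdihedral⁺ (l , true) (reflection∈⇒ l l∈))
      (λ where (r , false) r∈ → rotation∈⇐ r (∈-subdihedral⁻ (r , false) r∈)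
               (l , true)  l∈ → reflection∈⇐ l (∈-subdihedral⁻ (l , true) l∈))

  vertex-classification : ∀ {K} → IsVertex n K → ∀ {j} → (j , true) ∈ₛ K →
                          Σ ℕ λ e → e ∣ n × 3 ≤ e × K ≡ subdihedral e j
  vertex-classification {K} (K≤G , (x , x∉K) , K-not-normal) {j} j∈K =
    e , e∣n , 3≤ e∣n 1≤e K≡subdihedral , K≡subdihedral
    where
    open SubgroupWithReflection K≤G j∈K
    3≤ : ∀ {e} → e ∣ n → 1 ≤ e → K ≡ subdihedral e j → 3 ≤ e
    3≤ {1} _   _ K≡ = contradiction (subst (x ∈ₛ_) (sym K≡) (subdihedral-1-full x)) x∉K
    3≤ {2} 2∣n _ K≡ = contradiction (subst (IsNormal n) (sym K≡) (subdihedral-2-normal 2∣n)) K-not-normal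
    3≤ {suc (suc (suc _))} _ _ _ = s≤s (s≤s (s≤s z≤n))

module FixedVertices (n : ℕ) .{{_ : NonZero n}} (i : Fin n) where

  open Congruence
  open Parity
  open Dihedral n
  open Subgroups n
  open ReflectionConjugation n i
  open Classification n
  open import Data.Nat.Base as ℕ using (zero; suc; _≤_; _<_; z≤n; s≤s; _/_; >-nonZero)
  open import Data.Nat.Properties using (<-≤-trans; *-comm; +-identityʳ; m<m*n)
  open import Data.Nat.DivMod using (_mod_; m*n/n≡m)
  open import Data.Nat.Divisibility using (_∣_; divides; ∣-antisym)
  open import Data.Fin using (toℕ; #_)
  open import Data.Integer.Base using (ℤ; +_; _+_; _*_; -_; _-_; 0ℤ; -1ℤ)
  open import Data.Integer.Properties using (pos-+; pos-*)
  open import Data.Integer.Tactic.RingSolver using (solve-∀)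
  open import Data.Vec.Base using ([]; _∷_)
  open import Data.Bool.Base using (true; false)
  open import Data.Sum using (_⊎_; inj₁; inj₂)
  open import Data.Product using (Σ; _×_; _,_; proj₂)
  open import Relation.Binary.PropositionalEquality using (_≡_; _≢_; refl; sym; trans; cong; subst)

  -- the exponent of a^i b reflected: conjugation by a^i b sends a^l b to a^(2i - l) b
  mirror : ℤ → ℤ
  mirror x = (exponent i + exponent i) - x

  mirror-involutive : ∀ x → mirror (mirror x) ≡ x
  mirror-involutive x = ring (exponent i) x
    where ring : ∀ a x → (a + a) - ((a + a) - x) ≡ x
          ring = solve-∀

  module _ {e : ℕ} where

    mirror-cong : ∀ {x y} → x ≡[ e ] y → mirror x ≡[ e ] mirror y
    mirror-cong x≡y = +-congˡ-mod (exponent i + exponent i) (neg-cong-mod x≡y)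

    mirror-fixed : ∀ {j} → exponent i + exponent i ≡[ e ] exponent j + exponent j → mirror (exponent j) ≡[ e ] exponent j
    mirror-fixed {j} 2i≡2j = mod-trans (+-cong-mod 2i≡2j (mod-refl (- exponent j))) (≡⇒≡-mod (ring (exponent j)))
      where ring : ∀ y → (y + y) - y ≡ y
            ring = solve-∀

    mirror-fixed⁻¹ : ∀ {j} → mirror (exponent j) ≡[ e ] exponent j → exponent i + exponent i ≡[ e ] exponent j + exponent j
    mirror-fixed⁻¹ {j} mirror≡ = mod-trans (≡⇒≡-mod (ring (exponent i) (exponent j))) (+-cong-mod mirror≡ (mod-refl (exponent j)))
      where ring : ∀ a y → a + a ≡ ((a + a) - y) + y
            ring = solve-∀

  module _ {e : ℕ} (e∣n : e ∣ n) where

    rotation-conjugate-rot : ∀ r → rotation (conjugate (r , false)) ≡[ e ] - exponent r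
    rotation-conjugate-rot r = mod-trans (normalForm-sound-mod e∣n (i ∷ r ∷ []) ((ref (# 0) · rot (# 1)) · ref (# 0)))
                                         (≡⇒≡-mod (ring (exponent i) (exponent r)))
      where ring : ∀ x y → 0ℤ * x + (-1ℤ * y + 0ℤ) ≡ - y
            ring = solve-∀

    rotation-conjugate-ref : ∀ l → rotation (conjugate (l , true)) ≡[ e ] mirror (exponent l)
    rotation-conjugate-ref l = mod-trans (normalForm-sound-mod e∣n (i ∷ l ∷ []) ((ref (# 0) · ref (# 1)) · ref (# 0)))
                                         (≡⇒≡-mod (ring (exponent i) (exponent l)))
      where ring : ∀ x y → + 2 * x + (-1ℤ * y + 0ℤ) ≡ (x + x) - y
            ring = solve-∀

    private
      neg≡0⇒≡0 : ∀ {x} → - x ≡[ e ] 0ℤ → x ≡[ e ] 0ℤ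
      neg≡0⇒≡0 {x} -x≡0 = mod-trans (≡⇒≡-mod (ring x)) (neg-cong-mod -x≡0)
        where ring : ∀ x → x ≡ - - x
              ring = solve-∀

    conjugate-fixes-subdihedral : ∀ {j} → exponent i + exponent i ≡[ e ] exponent j + exponent j →
                                  conjugateSub (subdihedral e j) ≡ subdihedral e j
    conjugate-fixes-subdihedral {j} 2i≡2j = Sub-ext
      (λ where
        (r , false) r∈ → ∈-subdihedral⁺ (r , false) (neg≡0⇒≡0
          (mod-trans (mod-sym (rotation-conjugate-rot r)) (∈-subdihedral⁻ (conjugate (r , false)) (∈-conjugateSub⁻ (r , false) r∈))))
        (l , true) l∈ → ∈-subdihedral⁺ (l , true) (mod-trans (≡⇒≡-mod (sym (mirror-involutive (exponent l))))
          (mod-trans (mirror-cong (mod-trans (mod-sym (rotation-conjugate-ref l)) (∈-subdihedral⁻ (conjugate (l , true)) (∈-conjugateSub⁻ (l , true) l∈))))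
            (mirror-fixed 2i≡2j))))
      (λ where
        (r , false) r∈ → ∈-conjugateSub⁺ (r , false) (∈-subdihedral⁺ (conjugate (r , false))
          (mod-trans (rotation-conjugate-rot r) (neg-cong-mod (∈-subdihedral⁻ (r , false) r∈))))
        (l , true) l∈ → ∈-conjugateSub⁺ (l , true) (∈-subdihedral⁺ (conjugate (l , true))
          (mod-trans (rotation-conjugate-ref l) (mod-trans (mirror-cong (∈-subdihedral⁻ (l , true) l∈)) (mirror-fixed 2i≡2j)))))

    conjugate-fixes-subdihedral⁻¹ : ∀ {j} → conjugateSub (subdihedral e j) ≡ subdihedral e j →
                                    exponent i + exponent i ≡[ e ] exponent j + exponent j
    conjugate-fixes-subdihedral⁻¹ {j} fixed = mirror-fixed⁻¹ (mod-trans (mod-sym (rotation-conjugate-ref j))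
      (∈-subdihedral⁻ (conjugate (j , true)) (∈-conjugateSub⁻ (j , true) (subst ((j , true) ∈ₛ_) (sym fixed)
        (∈-subdihedral⁺ (j , true) (mod-refl (exponent j)))))))

  subdihedral-cong : ∀ {e j j'} → exponent j ≡[ e ] exponent j' → subdihedral e j ≡ subdihedral e j'
  subdihedral-cong {e} {j} {j'} j≡j' = Sub-ext
    (λ where (r , false) r∈ → ∈-subdihedral⁺ (r , false) (∈-subdihedral⁻ (r , false) r∈)
             (l , true)  l∈ → ∈-subdihedral⁺ (l , true) (mod-trans (∈-subdihedral⁻ (l , true) l∈) j≡j'))
    (λ where (r , false) r∈ → ∈-subdihedral⁺ (r , false) (∈-subdihedral⁻ (r , false) r∈)
             (l , true)  l∈ → ∈-subdihedral⁺ (l , true) (mod-trans (∈-subdihedral⁻ (l , true) l∈) (mod-sym j≡j')))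

  -- for even e, the second solution of 2j ≡ 2i (mod e)
  halfway : ℕ → Fin n
  halfway e = (toℕ i ℕ.+ e / 2) mod n

  module _ {e : ℕ} (e∣n : e ∣ n) where

    exponent-halfway : ∀ {f} → e ≡ f ℕ.* 2 → exponent (halfway e) ≡[ e ] exponent i + + f
    exponent-halfway {f} refl = ≡-mod-∣ e∣n (mod-trans (exponent-mod (toℕ i ℕ.+ f ℕ.* 2 / 2))
      (≡⇒≡-mod (trans (pos-+ (toℕ i) _) (cong (λ x → exponent i + + x) (m*n/n≡m f 2)))))

    private
      ++≡*2 : ∀ f → + f + + f ≡ + (f ℕ.* 2)
      ++≡*2 f = trans (sym (pos-+ f f)) (cong +_ (trans (cong (f ℕ.+_) (sym (+-identityʳ f))) (*-comm 2 f)))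

    halfway-fixed : 2 ∣ e → exponent i + exponent i ≡[ e ] exponent (halfway e) + exponent (halfway e)
    halfway-fixed (divides f e≡2f) = begin
      exponent i + exponent i                                   ≡⟨ ring (exponent i) (+ f) ⟩
      (exponent i + + f) + (exponent i + + f) + -1ℤ * (+ f + + f) ≡⟨ cong (λ x → (exponent i + + f) + (exponent i + + f) + -1ℤ * x)
                                                                        (trans (++≡*2 f) (cong +_ (sym e≡2f))) ⟩
      (exponent i + + f) + (exponent i + + f) + -1ℤ * + e        ≈⟨ congruent -1ℤ refl ⟩
      (exponent i + + f) + (exponent i + + f)                   ≈⟨ mod-sym (+-cong-mod (exponent-halfway e≡2f) (exponent-halfway e≡2f)) ⟩
      exponent (halfway e) + exponent (halfway e)               ∎
      where open ≡-mod-Reasoning e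
            ring : ∀ a f → a + a ≡ (a + f) + (a + f) + -1ℤ * (f + f)
            ring = solve-∀

    fixed-reflection-exponent : ∀ {j} .{{_ : NonZero e}} → exponent i + exponent i ≡[ e ] exponent j + exponent j →
      exponent j ≡[ e ] exponent i ⊎ (2 ∣ e × exponent j ≡[ e ] exponent (halfway e))
    fixed-reflection-exponent {j} 2i≡2j = from-halves (∣-double e d (≡0-mod⇒∣ (d ℕ.+ d) 2d≡0))
      where
      open ≡-mod-Reasoning e
      d = toℕ (addm n i (negm n j))

      d≡i-j : + d ≡[ e ] exponent i - exponent j
      d≡i-j = ≡-mod-∣ e∣n (mod-trans (exponent-addm i (negm n j)) (+-congˡ-mod (exponent i) (exponent-negm j)))

      2d≡0 : + (d ℕ.+ d) ≡[ e ] 0ℤ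
      2d≡0 = begin
        + (d ℕ.+ d)                                            ≡⟨ pos-+ d d ⟩
        + d + + d                                              ≈⟨ +-cong-mod d≡i-j d≡i-j ⟩
        (exponent i - exponent j) + (exponent i - exponent j)  ≡⟨ ring (exponent i) (exponent j) ⟩
        (exponent i + exponent i) - (exponent j + exponent j)  ≈⟨ ≡-mod⇒-≡0-mod 2i≡2j ⟩
        0ℤ                                                     ∎
        where ring : ∀ a b → (a - b) + (a - b) ≡ (a + a) - (b + b)
              ring = solve-∀

      j≡i-d : exponent j ≡[ e ] exponent i - + d
      j≡i-d = begin
        exponent j                                ≡⟨ ring (exponent i) (exponent j) ⟩
        exponent i - (exponent i - exponent j)    ≈⟨ +-congˡ-mod (exponent i) (neg-cong-mod (mod-sym d≡i-j)) ⟩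
        exponent i - + d                          ∎
        where ring : ∀ a b → b ≡ a - (a - b)
              ring = solve-∀

      from-halves : e ∣ d ⊎ Σ ℕ (λ f → e ≡ f ℕ.* 2 × Σ ℕ λ q → d ≡ f ℕ.+ q ℕ.* e) →
                    exponent j ≡[ e ] exponent i ⊎ (2 ∣ e × exponent j ≡[ e ] exponent (halfway e))
      from-halves (inj₁ e∣d) = inj₁ (begin
        exponent j         ≈⟨ j≡i-d ⟩
        exponent i - + d   ≈⟨ +-congˡ-mod (exponent i) (neg-cong-mod (∣⇒≡0-mod d e∣d)) ⟩
        exponent i - 0ℤ    ≡⟨ ring (exponent i) ⟩
        exponent i         ∎)
        where ring : ∀ a → a - 0ℤ ≡ a
              ring = solve-∀
      from-halves (inj₂ (f , e≡2f , q , d≡f+qe)) = inj₂ (divides f e≡2f , (begin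
        exponent j                                  ≈⟨ j≡i-d ⟩
        exponent i - + d                            ≈⟨ +-congˡ-mod (exponent i) (neg-cong-mod d≡f) ⟩
        exponent i - + f                            ≡⟨ ring (exponent i) (+ f) ⟩
        (exponent i + + f) + -1ℤ * (+ f + + f)      ≡⟨ cong (λ x → (exponent i + + f) + -1ℤ * x) (trans (++≡*2 f) (cong +_ (sym e≡2f))) ⟩
        (exponent i + + f) + -1ℤ * + e              ≈⟨ congruent -1ℤ refl ⟩
        exponent i + + f                            ≈⟨ mod-sym (exponent-halfway e≡2f) ⟩
        exponent (halfway e)                        ∎))
        where
        ring : ∀ a f → a - f ≡ (a + f) + -1ℤ * (f + f)
        ring = solve-∀
        d≡f : + d ≡[ e ] + f
        d≡f = congruent (+ q) (trans (cong +_ d≡f+qe) (trans (pos-+ f (q ℕ.* e)) (cong (λ x → + f + x) (pos-* q e))))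

  FixedForm : ℕ → Sub n → Set
  FixedForm e K = K ≡ subdihedral e i ⊎ (2 ∣ e × K ≡ subdihedral e (halfway e))

  private
    nonZero-≥3 : ∀ {e} → 3 ≤ e → NonZero e
    nonZero-≥3 3≤e = >-nonZero (<-≤-trans (s≤s z≤n) 3≤e)

    half-positive : ∀ {e} f → e ≡ f ℕ.* 2 → 3 ≤ e → 0 < f
    half-positive zero    refl ()
    half-positive (suc _) _    _ = s≤s z≤n

  fixed-vertex-form : ∀ {K} → IsVertex n K → conjugateSub K ≡ K → Σ ℕ λ e → e ∣ n × 3 ≤ e × FixedForm e K
  fixed-vertex-form {K} K-vertex fixed = classified (vertex-classification K-vertex (proj₂ (vertex-has-reflection K-vertex)))
    where
    classified : ∀ {j} → Σ ℕ (λ e → e ∣ n × 3 ≤ e × K ≡ subdihedral e j) → Σ ℕ λ e → e ∣ n × 3 ≤ e × FixedForm e K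
    classified {j} (e , e∣n , 3≤e , K≡) with fixed-reflection-exponent e∣n {{nonZero-≥3 3≤e}}
                                               (conjugate-fixes-subdihedral⁻¹ e∣n (subst (λ X → conjugateSub X ≡ X) K≡ fixed))
    ... | inj₁ j≡i          = e , e∣n , 3≤e , inj₁ (trans K≡ (subdihedral-cong j≡i))
    ... | inj₂ (2∣e , j≡h)  = e , e∣n , 3≤e , inj₂ (2∣e , trans K≡ (subdihedral-cong j≡h))

  form⇒fixed-vertex : ∀ {e K} → e ∣ n → 3 ≤ e → FixedForm e K → IsVertex n K × conjugateSub K ≡ K
  form⇒fixed-vertex e∣n 3≤e (inj₁ refl) =
    subdihedral-vertex e∣n 3≤e , conjugate-fixes-subdihedral e∣n (mod-refl (exponent i + exponent i))
  form⇒fixed-vertex e∣n 3≤e (inj₂ (2∣e , refl)) =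
    subdihedral-vertex e∣n 3≤e , conjugate-fixes-subdihedral e∣n (halfway-fixed e∣n 2∣e)

  -- e is recovered from subdihedral e j as the least positive exponent of a rotation in it
  subdihedral-injectiveˡ : ∀ {e e' j j'} → e ∣ n → e' ∣ n → 3 ≤ e → 3 ≤ e' → subdihedral e j ≡ subdihedral e' j' → e ≡ e'
  subdihedral-injectiveˡ {e} {e'} e∣n e'∣n 3≤e 3≤e' eq = ∣-antisym (divides-other e'∣n e∣n 3≤e (sym eq)) (divides-other e∣n e'∣n 3≤e' eq)
    where
    divides-other : ∀ {e e' j j'} → e ∣ n → e' ∣ n → 3 ≤ e' → subdihedral e j ≡ subdihedral e' j' → e' ∣ e
    divides-other {e} {e'} {j} {j'} e∣n e'∣n 3≤e' eq = ≡0-mod⇒∣ {{nonZero-≥3 3≤e'}} e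
      (mod-trans (mod-sym (≡-mod-∣ e'∣n (exponent-mod e)))
        (∈-subdihedral⁻ (a^ e) (subst (a^ e ∈ₛ_) eq (∈-subdihedral⁺ (a^ e) (mod-trans (≡-mod-∣ e∣n (exponent-mod e)) modulus≡0-mod)))))

  subdihedral-i≢halfway : ∀ {e} → e ∣ n → 3 ≤ e → 2 ∣ e → subdihedral e i ≢ subdihedral e (halfway e)
  subdihedral-i≢halfway {e} e∣n 3≤e (divides f e≡2f) eq =
    positive-<⇒≢0-mod {{nonZero-≥3 3≤e}} 0<f f<e (begin
      + f                                ≡⟨ ring (exponent i) (+ f) ⟩
      (exponent i + + f) - exponent i    ≈⟨ +-cong-mod (mod-sym (exponent-halfway e∣n e≡2f)) (neg-cong-mod i≡h) ⟩
      exponent (halfway e) - exponent (halfway e)   ≡⟨ ring' (exponent (halfway e)) ⟩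
      0ℤ                                 ∎)
    where
    open ≡-mod-Reasoning e
    ring : ∀ a f → f ≡ (a + f) - a
    ring = solve-∀
    ring' : ∀ a → a - a ≡ 0ℤ
    ring' = solve-∀
    i≡h : exponent i ≡[ e ] exponent (halfway e)
    i≡h = ∈-subdihedral⁻ (i , true) (subst ((i , true) ∈ₛ_) eq (∈-subdihedral⁺ (i , true) (mod-refl (exponent i))))
    0<f : 0 < f
    0<f = half-positive f e≡2f 3≤e
    f<e : f < e
    f<e = subst (f <_) (sym e≡2f) (m<m*n f 2 {{>-nonZero 0<f}} (s≤s (s≤s z≤n)))

module Divisors where

  open Counting
  open Parity using (odd-∣-2^a*⇒∣)
  open import Data.Nat.Base as ℕ using (ℕ; zero; suc; _*_; _^_; _≤_; s≤s; z≤n; NonZero; _/_; parity)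
  open import Data.Nat.Properties using (<-cmp; *-mono-<; *-comm; *-zeroʳ; <⇒≢; _≟_; _≤?_)
  open import Data.Nat.DivMod using (m*n/n≡m; m/n*n≡m)
  open import Data.Nat.Divisibility using (_∣_; divides; _∣?_; ∣⇒≤; 0∣⇒≡0; ∣-trans; 1∣_)
  open import Data.Parity.Base using (0ℙ; 1ℙ)
  open import Data.List.Base using (List; []; _∷_; length; filter; upTo)
  open import Data.List.Membership.Propositional using (_∈_)
  open import Data.List.Membership.Propositional.Properties using (∈-filter⁻; ∈-filter⁺; ∈-upTo⁺)
  open import Data.List.Relation.Unary.Any using (here; there)
  open import Data.List.Relation.Unary.Unique.Propositional using (Unique; [])
  open import Data.List.Relation.Unary.Unique.Propositional.Properties using (filter⁺; upTo⁺)
  open import Data.Product using (∃; _×_; _,_; proj₁; proj₂)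
  open import Function.Bundles using (_⇔_; mk⇔)
  open import Relation.Nullary using (¬_; contradiction)
  open import Relation.Nullary.Decidable using (¬?)
  open import Relation.Unary using (Decidable)
  open import Relation.Binary.Definitions using (tri<; tri≈; tri>)
  open import Relation.Binary.PropositionalEquality using (_≡_; _≢_; refl; sym; trans; cong; subst)

  IsSquare : ℕ → Set
  IsSquare m = ∃ λ s → s * s ≡ m

  square-root-unique : ∀ {a b} → a * a ≡ b * b → a ≡ b
  square-root-unique {a} {b} eq with <-cmp a b
  ... | tri≈ _ a≡b _ = a≡b
  ... | tri< a<b _ _ = contradiction eq (<⇒≢ (*-mono-< a<b a<b))
  ... | tri> _ _ a>b = contradiction (sym eq) (<⇒≢ (*-mono-< a>b a>b))

  divisors : ℕ → List ℕ
  divisors m = filter (_∣? m) (upTo (suc m))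

  divisors-unique : ∀ m → Unique (divisors m)
  divisors-unique m = filter⁺ (_∣? m) (upTo⁺ (suc m))

  ∈-divisors⁻ : ∀ {m e} → e ∈ divisors m → e ∣ m
  ∈-divisors⁻ {m} e∈ = proj₂ (∈-filter⁻ (_∣? m) {xs = upTo (suc m)} e∈)

  ∈-divisors⁺ : ∀ {m e} → .{{NonZero m}} → e ∣ m → e ∈ divisors m
  ∈-divisors⁺ {suc m} e∣m = ∈-filter⁺ (_∣? suc m) (∈-upTo⁺ (s≤s (∣⇒≤ e∣m))) e∣m

  module _ (m : ℕ) .{{_ : NonZero m}} where

    -- e ↦ m / e pairs off the divisors; its fixed points are the square roots of m
    complement : ℕ → ℕ
    complement zero    = zero
    complement (suc e) = m / suc e

    private
      divisor-nonZero : ∀ {e} → e ∣ m → e ≢ 0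
      divisor-nonZero e∣m refl = ℕ.≢-nonZero⁻¹ m (0∣⇒≡0 e∣m)

      m≡e*complement : ∀ e → suc e ∣ m → m ≡ suc e * (m / suc e)
      m≡e*complement e e∣m = trans (sym (m/n*n≡m e∣m)) (*-comm (m / suc e) (suc e))

    complement-∣ : ∀ {e} → e ∣ m → complement e ∣ m
    complement-∣ {zero}  e∣m = e∣m
    complement-∣ {suc e} e∣m = divides (suc e) (m≡e*complement e e∣m)

    complement-involutive : ∀ {e} → e ∣ m → complement (complement e) ≡ e
    complement-involutive {zero}  e∣m = refl
    complement-involutive {suc e} e∣m with m / suc e | m≡e*complement e e∣m
    ... | zero  | m≡0 = contradiction (trans m≡0 (*-zeroʳ (suc e))) (ℕ.≢-nonZero⁻¹ m)
    ... | suc k | m≡ = trans (cong (_/ suc k) m≡) (m*n/n≡m (suc e) (suc k))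

    fixed⇒square : ∀ {e} → e ∣ m → complement e ≡ e → e * e ≡ m
    fixed⇒square {zero}  e∣m _     = contradiction refl (divisor-nonZero e∣m)
    fixed⇒square {suc e} e∣m fixed = trans (cong (suc e *_) (sym fixed)) (sym (m≡e*complement e e∣m))

    square⇒fixed : ∀ {e} → e * e ≡ m → complement e ≡ e
    square⇒fixed {zero}  0≡m  = contradiction (sym 0≡m) (ℕ.≢-nonZero⁻¹ m)
    square⇒fixed {suc e} e*e≡m = trans (cong (_/ suc e) (sym e*e≡m)) (m*n/n≡m (suc e) (suc e))

    open Involution _≟_ complement

    square-roots : List ℕ
    square-roots = fixedPoints (divisors m)

    ∈-square-roots⁻ : ∀ {e} → e ∈ square-roots → e * e ≡ m
    ∈-square-roots⁻ e∈ = let e∈divs , fixed = ∈-filter⁻ isFixed? {xs = divisors m} e∈ in fixed⇒square (∈-divisors⁻ e∈divs) fixed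

    ∈-square-roots⁺ : ∀ e → e * e ≡ m → e ∈ square-roots
    ∈-square-roots⁺ e e*e≡m = ∈-filter⁺ isFixed? (∈-divisors⁺ (divides e (sym e*e≡m))) (square⇒fixed e*e≡m)

    length-square-roots-square : ∀ s → s * s ≡ m → length square-roots ≡ 1
    length-square-roots-square s s*s≡m = length-unique-cong (filter⁺ isFixed? (divisors-unique m)) (unique-∷ (λ ()) [])
      (λ {e} → mk⇔ (λ e∈ → here (square-root-unique (trans (∈-square-roots⁻ e∈) (sym s*s≡m))))
                   (λ where (here refl) → ∈-square-roots⁺ s s*s≡m))

    length-square-roots-nonsquare : ¬ IsSquare m → length square-roots ≡ 0
    length-square-roots-nonsquare nonsquare = length-unique-cong (filter⁺ isFixed? (divisors-unique m)) []
      (λ {e} → mk⇔ (λ e∈ → contradiction (e , ∈-square-roots⁻ e∈) nonsquare) (λ ()))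

    parity-divisors : parity (length (divisors m)) ≡ parity (length square-roots)
    parity-divisors = parity-length≡parity-fixedPoints (divisors-unique m) (record
      { closed     = λ e∈ → ∈-divisors⁺ (complement-∣ (∈-divisors⁻ e∈))
      ; involutive = λ e∈ → complement-involutive (∈-divisors⁻ e∈)
      })

    even-divisor-count⇔nonsquare : parity (length (divisors m)) ≡ 0ℙ ⇔ (¬ IsSquare m)
    even-divisor-count⇔nonsquare = mk⇔
      (λ even (s , s*s≡m) → case (trans (sym even) (trans parity-divisors (cong parity (length-square-roots-square s s*s≡m)))))
      (λ nonsquare → trans parity-divisors (cong parity (length-square-roots-nonsquare nonsquare)))
      where case : 0ℙ ≡ 1ℙ → _
            case ()

  odd? : Decidable (λ e → ¬ 2 ∣ e)
  odd? e = ¬? (2 ∣? e)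

  large-divisors : ℕ → List ℕ
  large-divisors n = filter (3 ≤?_) (divisors n)

  large-divisors-unique : ∀ n → Unique (large-divisors n)
  large-divisors-unique n = filter⁺ (3 ≤?_) (divisors-unique n)

  ∈-large-divisors⁻ : ∀ {n e} → e ∈ large-divisors n → e ∣ n × 3 ≤ e
  ∈-large-divisors⁻ {n} e∈ = let e∈divs , 3≤e = ∈-filter⁻ (3 ≤?_) {xs = divisors n} e∈ in ∈-divisors⁻ e∈divs , 3≤e

  ∈-large-divisors⁺ : ∀ {n e} .{{_ : NonZero n}} → e ∣ n → 3 ≤ e → e ∈ large-divisors n
  ∈-large-divisors⁺ e∣n 3≤e = ∈-filter⁺ (3 ≤?_) (∈-divisors⁺ e∣n) 3≤e

  factor-nonZero : ∀ {n} .{{_ : NonZero n}} a m → n ≡ 2 ^ a * m → NonZero m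
  factor-nonZero {n} a m n≡2^am = ℕ.≢-nonZero λ { refl → ℕ.≢-nonZero⁻¹ n (trans n≡2^am (*-zeroʳ (2 ^ a))) }

  -- the odd divisors of n = 2^a m are those of m: 1 and the odd large divisors of n
  length-divisors-odd-part : ∀ {n} .{{_ : NonZero n}} a m → n ≡ 2 ^ a * m → ¬ 2 ∣ m →
                             length (divisors m) ≡ suc (length (filter odd? (large-divisors n)))
  length-divisors-odd-part {n} a m n≡2^am m-odd = length-unique-cong (divisors-unique m)
    (unique-∷ 1∉ (filter⁺ odd? (large-divisors-unique n))) (λ {e} → mk⇔ (to e) from)
    where
    instance
      m-nonZero : NonZero m
      m-nonZero = factor-nonZero a m n≡2^am
    m∣n : m ∣ n
    m∣n = divides (2 ^ a) n≡2^am
    1∉ : ¬ 1 ∈ filter odd? (large-divisors n)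
    1∉ 1∈ with ∈-large-divisors⁻ {n} (proj₁ (∈-filter⁻ odd? {xs = large-divisors n} 1∈))
    ... | _ , s≤s ()
    to : ∀ e → e ∈ divisors m → e ∈ 1 ∷ filter odd? (large-divisors n)
    to 0 e∈ = contradiction (0∣⇒≡0 (∈-divisors⁻ e∈)) (ℕ.≢-nonZero⁻¹ m)
    to 1 _  = here refl
    to 2 e∈ = contradiction (∈-divisors⁻ e∈) m-odd
    to (suc (suc (suc e))) e∈ = there (∈-filter⁺ odd? (∈-large-divisors⁺ (∣-trans (∈-divisors⁻ e∈) m∣n) (s≤s (s≤s (s≤s z≤n))))
                                                      (λ 2∣e → m-odd (∣-trans 2∣e (∈-divisors⁻ e∈))))
    from : ∀ {e} → e ∈ 1 ∷ filter odd? (large-divisors n) → e ∈ divisors m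
    from (here refl) = ∈-divisors⁺ (1∣ m)
    from (there e∈) = let e∈large , e-odd = ∈-filter⁻ odd? {xs = large-divisors n} e∈ in
      ∈-divisors⁺ (odd-∣-2^a*⇒∣ a m e-odd (subst (_ ∣_) n≡2^am (proj₁ (∈-large-divisors⁻ {n} e∈large))))

module Squares where

  open Divisors using (IsSquare)
  open import Data.Nat.Base as ℕ using (ℕ; zero; suc; _+_; _*_; _^_; _≤_; _<_; z≤n; s≤s; NonZero; _/_; >-nonZero)
  open import Data.Nat.Properties using (*-mono-≤; ^-distribˡ-+-*; *-cancelˡ-≡; m<m*n; ≤-trans; ≤-pred; ≤-refl; +-identityʳ; m^n>0)
  open import Data.Nat.DivMod using (m*n/n≡m)
  open import Data.Nat.Divisibility using (_∣_; divides; _∣?_; ∣1⇒≡1)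
  open import Data.Nat.Primality using (Prime; euclidsLemma; prime⇒irreducible; prime⇒nonZero; prime⇒nonTrivial)
  open import Data.Nat.Tactic.RingSolver using (solve-∀)
  open import Data.Fin.Base as Fin using (Fin)
  open import Data.Fin.Properties using (suc-injective; ¬∀⟶∃¬)
  open import Data.Sum using (inj₁; inj₂)
  open import Data.Product using (Σ; ∃; _×_; _,_)
  open import Function.Bundles using (_⇔_; mk⇔)
  open import Relation.Nullary using (¬_; yes; no; contradiction)
  open import Relation.Binary.PropositionalEquality using (_≡_; _≢_; refl; sym; trans; cong; cong₂; subst)

  prodF-cong : ∀ k {f g : Fin k → ℕ} → (∀ i → f i ≡ g i) → prodF k f ≡ prodF k g
  prodF-cong zero    _   = refl
  prodF-cong (suc k) f≗g = cong₂ _*_ (f≗g Fin.zero) (prodF-cong k (λ i → f≗g (Fin.suc i)))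

  prodF-* : ∀ k (f g : Fin k → ℕ) → prodF k (λ i → f i * g i) ≡ prodF k f * prodF k g
  prodF-* zero    f g = refl
  prodF-* (suc k) f g =
    trans (cong (f Fin.zero * g Fin.zero *_) (prodF-* k (λ i → f (Fin.suc i)) (λ i → g (Fin.suc i))))
          (ring (f Fin.zero) (g Fin.zero) (prodF k (λ i → f (Fin.suc i))) (prodF k (λ i → g (Fin.suc i))))
    where ring : ∀ a b c d → a * b * (c * d) ≡ a * c * (b * d)
          ring = solve-∀

  prodF-positive : ∀ k (f : Fin k → ℕ) → (∀ i → 1 ≤ f i) → 1 ≤ prodF k f
  prodF-positive zero    f _        = s≤s z≤n
  prodF-positive (suc k) f positive =
    *-mono-≤ (positive Fin.zero) (prodF-positive k (λ i → f (Fin.suc i)) (λ i → positive (Fin.suc i)))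

  all-even⇒square : ∀ k p α → (∀ i → 2 ∣ α i) → IsSquare (factorValue k p α)
  all-even⇒square k p α even = prodF k (λ i → p i ^ (α i / 2)) ,
    trans (sym (prodF-* k _ _)) (prodF-cong k λ i →
      trans (sym (^-distribˡ-+-* (p i) (α i / 2) (α i / 2))) (cong (p i ^_) (halves (even i))))
    where halves : ∀ {a} → 2 ∣ a → a / 2 + a / 2 ≡ a
          halves (divides q refl) = trans (cong (λ h → h + h) (m*n/n≡m q 2)) (ring q)
            where ring : ∀ q → q + q ≡ q * 2
                  ring = solve-∀

  module _ {P : ℕ} (P-prime : Prime P) where

    private
      instance
        P-nonZero : NonZero P
        P-nonZero = prime⇒nonZero P-prime
      P≢1 : P ≢ 1
      P≢1 = ℕ.nonTrivial⇒≢1 {{prime⇒nonTrivial P-prime}}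

    ∤-* : ∀ {a b} → ¬ P ∣ a → ¬ P ∣ b → ¬ P ∣ a * b
    ∤-* {a} {b} P∤a P∤b P∣ab with euclidsLemma a b P-prime P∣ab
    ... | inj₁ P∣a = P∤a P∣a
    ... | inj₂ P∣b = P∤b P∣b

    ∤-prime-^ : ∀ {q} → Prime q → P ≢ q → ∀ a → ¬ P ∣ q ^ a
    ∤-prime-^ q-prime P≢q zero    P∣1 = P≢1 (∣1⇒≡1 P∣1)
    ∤-prime-^ q-prime P≢q (suc a) = ∤-* P∤q (∤-prime-^ q-prime P≢q a)
      where P∤q : ¬ P ∣ _
            P∤q P∣q with prime⇒irreducible q-prime P∣q
            ... | inj₁ P≡1 = P≢1 P≡1
            ... | inj₂ P≡q = P≢q P≡q

    ∤-prodF : ∀ k (f : Fin k → ℕ) → (∀ j → ¬ P ∣ f j) → ¬ P ∣ prodF k f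
    ∤-prodF zero    f _   P∣1 = P≢1 (∣1⇒≡1 P∣1)
    ∤-prodF (suc k) f P∤f = ∤-* (P∤f Fin.zero) (∤-prodF k (λ j → f (Fin.suc j)) (λ j → P∤f (Fin.suc j)))

    private
      positive-factor : ∀ q {s} → s ≡ q * P → 1 ≤ s → 1 ≤ q
      positive-factor zero    refl ()
      positive-factor (suc _) _    _ = s≤s z≤n

    factor-out : ∀ s → 1 ≤ s → Σ ℕ λ c → Σ ℕ λ t → s ≡ P ^ c * t × ¬ P ∣ t
    factor-out s = bounded s s ≤-refl
      where
      bounded : ∀ N s → s ≤ N → 1 ≤ s → Σ ℕ λ c → Σ ℕ λ t → s ≡ P ^ c * t × ¬ P ∣ t
      bounded N s s≤N 1≤s with P ∣? s
      ... | no P∤s = 0 , s , sym (+-identityʳ s) , P∤s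
      bounded zero    s s≤N 1≤s | yes _ = contradiction (≤-trans 1≤s s≤N) λ ()
      bounded (suc N) s s≤N 1≤s | yes (divides q s≡qP) with bounded N q (≤-pred (≤-trans q<s s≤N)) 1≤q
        where
        1≤q : 1 ≤ q
        1≤q = positive-factor q s≡qP 1≤s
        q<s : q < s
        q<s = subst (q <_) (sym s≡qP) (m<m*n q P {{>-nonZero 1≤q}} (ℕ.nonTrivial⇒n>1 P {{prime⇒nonTrivial P-prime}}))
      ... | c , t , q≡ , P∤t = suc c , t , trans s≡qP (trans (cong (_* P) q≡) (ring (P ^ c) t P)) , P∤t
        where ring : ∀ x t P → x * t * P ≡ P * x * t
              ring = solve-∀

    valuation-unique : ∀ a b {u w} → P ^ a * u ≡ P ^ b * w → ¬ P ∣ u → ¬ P ∣ w → a ≡ b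
    valuation-unique zero    zero    _  _   _   = refl
    valuation-unique zero    (suc b) {u} {w} eq P∤u _ =
      contradiction (divides (P ^ b * w) (trans (trans (sym (+-identityʳ u)) eq) (ring P (P ^ b) w))) P∤u
      where ring : ∀ P x w → P * x * w ≡ x * w * P
            ring = solve-∀
    valuation-unique (suc a) zero    {u} {w} eq _ P∤w =
      contradiction (divides (P ^ a * u) (trans (trans (sym (+-identityʳ w)) (sym eq)) (ring P (P ^ a) u))) P∤w
      where ring : ∀ P x w → P * x * w ≡ x * w * P
            ring = solve-∀
    valuation-unique (suc a) (suc b) {u} {w} eq P∤u P∤w = cong suc (valuation-unique a b
      (*-cancelˡ-≡ _ _ P (trans (sym (ring P (P ^ a) u)) (trans eq (ring P (P ^ b) w)))) P∤u P∤w)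
      where ring : ∀ P x w → P * x * w ≡ P * (x * w)
            ring = solve-∀

  module _ k (p α : Fin k → ℕ) (p-prime : ∀ i → Prime (p i)) (p-injective : ∀ i j → p i ≡ p j → i ≡ j) where

    factorValue-split : ∀ i → Σ ℕ λ r → factorValue k p α ≡ p i ^ α i * r × ¬ p i ∣ r
    factorValue-split = split k p α p-prime p-injective
      where
      split : ∀ k (p α : Fin k → ℕ) → (∀ i → Prime (p i)) → (∀ i j → p i ≡ p j → i ≡ j) →
              ∀ i → Σ ℕ λ r → factorValue k p α ≡ p i ^ α i * r × ¬ p i ∣ r
      split (suc k) p α prime inj Fin.zero = prodF k (λ j → p (Fin.suc j) ^ α (Fin.suc j)) , refl ,
        ∤-prodF (prime Fin.zero) k _ (λ j → ∤-prime-^ (prime Fin.zero) (prime (Fin.suc j)) (λ eq → 0≢suc (inj _ _ eq)) (α (Fin.suc j)))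
        where 0≢suc : ∀ {j : Fin k} → Fin.zero ≢ Fin.suc j
              0≢suc ()
      split (suc k) p α prime inj (Fin.suc i) with split k (λ j → p (Fin.suc j)) (λ j → α (Fin.suc j)) (λ j → prime (Fin.suc j))
                                                     (λ a b eq → suc-injective (inj _ _ eq)) i
      ... | r , eq , p∤r = p Fin.zero ^ α Fin.zero * r ,
            trans (cong (p Fin.zero ^ α Fin.zero *_) eq) (ring (p Fin.zero ^ α Fin.zero) (p (Fin.suc i) ^ α (Fin.suc i)) r) ,
            ∤-* (prime (Fin.suc i)) (∤-prime-^ (prime (Fin.suc i)) (prime Fin.zero) (λ eq → suc≢0 (inj _ _ eq)) (α Fin.zero)) p∤r
        where ring : ∀ x y r → x * (y * r) ≡ y * (x * r)
              ring = solve-∀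
              suc≢0 : Fin.suc i ≢ Fin.zero
              suc≢0 ()

    private
      factorValue-positive : 1 ≤ factorValue k p α
      factorValue-positive = prodF-positive k _ (λ i → m^n>0 (p i) {{prime⇒nonZero (p-prime i)}} (α i))

      square-positive : ∀ s → s * s ≡ factorValue k p α → 1 ≤ s
      square-positive zero    0≡ = subst (1 ≤_) (sym 0≡) factorValue-positive
      square-positive (suc _) _  = s≤s z≤n

    -- compare the p i-adic valuations of s * s and of factorValue k p α
    square⇒all-even : IsSquare (factorValue k p α) → ∀ i → 2 ∣ α i
    square⇒all-even (s , s*s≡) i = compare (factorValue-split i) (factor-out (p-prime i) s 1≤s)
      where
      1≤s : 1 ≤ s
      1≤s = square-positive s s*s≡
      compare : (Σ ℕ λ r → factorValue k p α ≡ p i ^ α i * r × ¬ p i ∣ r) →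
                (Σ ℕ λ c → Σ ℕ λ t → s ≡ p i ^ c * t × ¬ p i ∣ t) → 2 ∣ α i
      compare (r , fv≡ , p∤r) (c , t , s≡ , p∤t) =
        divides c (trans (valuation-unique (p-prime i) (α i) (c + c) eq p∤r (∤-* (p-prime i) p∤t p∤t)) (ring c))
        where
        ring : ∀ c → c + c ≡ c * 2
        ring = solve-∀
        ring' : ∀ x t → x * t * (x * t) ≡ x * x * (t * t)
        ring' = solve-∀
        eq : p i ^ α i * r ≡ p i ^ (c + c) * (t * t)
        eq = trans (sym fv≡) (trans (sym s*s≡) (trans (cong (λ x → x * x) s≡)
               (trans (ring' (p i ^ c) t) (cong (_* (t * t)) (sym (^-distribˡ-+-* (p i) c c))))))

  nonsquare⇔odd-exponent : ∀ k p α → PrimePowerData k p α → (¬ IsSquare (factorValue k p α)) ⇔ (∃ λ i → ¬ 2 ∣ α i)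
  nonsquare⇔odd-exponent k p α (prime , injective , _) = mk⇔
    (λ nonsquare → ¬∀⟶∃¬ k (λ i → 2 ∣ α i) (λ i → 2 ∣? α i) (λ all-even → nonsquare (all-even⇒square k p α all-even)))
    (λ (i , α-odd) square → α-odd (square⇒all-even k p α prime injective square i))

module FixedVertexCount (n : ℕ) .{{_ : NonZero n}} (i : Fin n) where

  open Counting
  open Divisors
  open Subgroups n
  open ReflectionConjugation n i
  open Classification n
  open FixedVertices n i
  open import Data.Nat.Base using (_+_; _≤_; parity)
  import Data.Parity.Base as ℙ
  open import Data.Parity.Properties using (+-homo-+)
  open import Data.Nat.Divisibility using (_∣_; _∣?_)
  open import Data.List.Base using (List; []; _∷_; _++_; length; filter; concatMap)
  open import Data.List.Properties using (length-++; filter-accept; filter-reject; filter-++)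
  open import Data.List.Membership.Propositional using (_∈_)
  open import Data.List.Membership.Propositional.Properties using (∈-++⁻; ∈-++⁺ˡ; ∈-++⁺ʳ)
  open import Data.List.Relation.Unary.Any using (here; there)
  open import Data.List.Relation.Unary.Unique.Propositional using (Unique; []; _∷_)
  open import Data.List.Relation.Unary.Unique.Propositional.Properties using (++⁺)
  open import Data.Sum using (inj₁; inj₂)
  open import Data.Product using (Σ; _×_; _,_; proj₁; proj₂)
  open import Function.Bundles using (_⇔_; mk⇔)
  open import Relation.Nullary using (¬_; Dec; yes; no; contradiction)
  open import Relation.Binary.PropositionalEquality using (_≡_; refl; sym; trans; cong; cong₂; subst)
  import Relation.Binary.PropositionalEquality

  -- the τ-invariant vertices with rotation subgroup ⟨a^e⟩
  fixedAt : ℕ → List (Sub n)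
  fixedAt e = subdihedral e i ∷ second (2 ∣? e)
    where second : Dec (2 ∣ e) → List (Sub n)
          second (yes _) = subdihedral e (halfway e) ∷ []
          second (no _)  = []

  ∈-fixedAt⁻ : ∀ {e K} → K ∈ fixedAt e → FixedForm e K
  ∈-fixedAt⁻ {e} (here refl) = inj₁ refl
  ∈-fixedAt⁻ {e} (there K∈) with 2 ∣? e
  ∈-fixedAt⁻ {e} (there (here refl)) | yes 2∣e = inj₂ (2∣e , refl)

  ∈-fixedAt⁺ : ∀ {e K} → FixedForm e K → K ∈ fixedAt e
  ∈-fixedAt⁺ (inj₁ refl) = here refl
  ∈-fixedAt⁺ {e} (inj₂ (2∣e , refl)) with 2 ∣? e
  ... | yes _   = there (here refl)
  ... | no 2∤e  = contradiction 2∣e 2∤e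

  fixedAt-unique : ∀ {e} → e ∣ n × 3 ≤ e → Unique (fixedAt e)
  fixedAt-unique {e} (e∣n , 3≤e) with 2 ∣? e
  ... | yes 2∣e = unique-∷ (λ where (here eq) → subdihedral-i≢halfway e∣n 3≤e 2∣e eq) (unique-∷ (λ ()) [])
  ... | no _    = unique-∷ (λ ()) []

  parity-fixedAt : ∀ e → parity (length (fixedAt e)) ≡ parity (length (filter odd? (e ∷ [])))
  parity-fixedAt e with 2 ∣? e
  ... | yes 2∣e = cong (λ xs → parity (length xs)) (sym (filter-reject odd? {xs = []} (λ 2∤e → 2∤e 2∣e)))
  ... | no 2∤e  = cong (λ xs → parity (length xs)) (sym (filter-accept odd? {xs = []} 2∤e))

  fixedVertices : List (Sub n)
  fixedVertices = concatMap fixedAt (large-divisors n)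

  ∈-fixedVertices⁻ : ∀ {xs K} → K ∈ concatMap fixedAt xs → Σ ℕ λ e → e ∈ xs × FixedForm e K
  ∈-fixedVertices⁻ {e ∷ xs} K∈ with ∈-++⁻ (fixedAt e) K∈
  ... | inj₁ K∈e  = e , here refl , ∈-fixedAt⁻ K∈e
  ... | inj₂ K∈xs = let e' , e'∈xs , form = ∈-fixedVertices⁻ K∈xs in e' , there e'∈xs , form

  ∈-fixedVertices⁺ : ∀ {xs e K} → e ∈ xs → FixedForm e K → K ∈ concatMap fixedAt xs
  ∈-fixedVertices⁺ {e ∷ xs} (here refl) form = ∈-++⁺ˡ (∈-fixedAt⁺ form)
  ∈-fixedVertices⁺ {x ∷ xs} (there e∈xs) form = ∈-++⁺ʳ (fixedAt x) (∈-fixedVertices⁺ e∈xs form)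

  ∈-fixedVertices : ∀ K → K ∈ fixedVertices ⇔ (IsVertex n K × conjugateSub K ≡ K)
  ∈-fixedVertices K = mk⇔
    (λ K∈ → let e , e∈ , form = ∈-fixedVertices⁻ K∈ ; e∣n , 3≤e = ∈-large-divisors⁻ {n} e∈ in form⇒fixed-vertex e∣n 3≤e form)
    (λ (K-vertex , fixed) → let e , e∣n , 3≤e , form = fixed-vertex-form K-vertex fixed in
       ∈-fixedVertices⁺ (∈-large-divisors⁺ e∣n 3≤e) form)

  private
    form-subdihedral : ∀ {e K} → FixedForm e K → Σ (Fin n) λ j → K ≡ subdihedral e j
    form-subdihedral (inj₁ K≡)       = i , K≡
    form-subdihedral {e} (inj₂ (_ , K≡)) = halfway e , K≡

  fixedVertices-unique : Unique fixedVertices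
  fixedVertices-unique = concatMap-unique (large-divisors n) (large-divisors-unique n) (∈-large-divisors⁻ {n})
    where
    concatMap-unique : ∀ xs → Unique xs → (∀ {e} → e ∈ xs → e ∣ n × 3 ≤ e) → Unique (concatMap fixedAt xs)
    concatMap-unique []       _   _     = []
    concatMap-unique (e ∷ xs) !e∷xs large =
      ++⁺ (fixedAt-unique (large (here refl))) (concatMap-unique xs (unique-tail !e∷xs) (λ e∈ → large (there e∈))) disjoint
      where
      disjoint : ∀ {K} → ¬ (K ∈ fixedAt e × K ∈ concatMap fixedAt xs)
      disjoint (K∈e , K∈xs) with form-subdihedral (∈-fixedAt⁻ K∈e) | ∈-fixedVertices⁻ K∈xs
      ... | j , K≡ | e' , e'∈xs , form' with form-subdihedral form'
      ...   | j' , K≡' = unique-head !e∷xs (subst (_∈ xs) (sym e≡e') e'∈xs)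
        where
        e≡e' = subdihedral-injectiveˡ (proj₁ (large (here refl))) (proj₁ (large (there e'∈xs)))
                                      (proj₂ (large (here refl))) (proj₂ (large (there e'∈xs))) (trans (sym K≡) K≡')

  parity-fixedVertices : parity (length fixedVertices) ≡ parity (length (filter odd? (large-divisors n)))
  parity-fixedVertices = parity-concatMap (large-divisors n)
    where
    open Relation.Binary.PropositionalEquality.≡-Reasoning
    parity-concatMap : ∀ xs → parity (length (concatMap fixedAt xs)) ≡ parity (length (filter odd? xs))
    parity-concatMap []       = refl
    parity-concatMap (e ∷ xs) = begin
      parity (length (fixedAt e ++ concatMap fixedAt xs))
        ≡⟨ cong parity (length-++ (fixedAt e)) ⟩
      parity (length (fixedAt e) + length (concatMap fixedAt xs))
        ≡⟨ +-homo-+ (length (fixedAt e)) _ ⟩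
      parity (length (fixedAt e)) ℙ.+ parity (length (concatMap fixedAt xs))
        ≡⟨ cong₂ ℙ._+_ (parity-fixedAt e) (parity-concatMap xs) ⟩
      parity (length (filter odd? (e ∷ []))) ℙ.+ parity (length (filter odd? xs))
        ≡⟨ sym (+-homo-+ (length (filter odd? (e ∷ []))) _) ⟩
      parity (length (filter odd? (e ∷ [])) + length (filter odd? xs))
        ≡⟨ cong parity (sym (length-++ (filter odd? (e ∷ [])))) ⟩
      parity (length (filter odd? (e ∷ []) ++ filter odd? xs))
        ≡⟨ cong (λ ys → parity (length ys)) (sym (filter-++ odd? (e ∷ []) xs)) ⟩
      parity (length (filter odd? (e ∷ xs)))   ∎

module Decidability (n : ℕ) .{{_ : NonZero n}} where

  open Subgroups n
  open import Data.Nat.Base using (zero; suc)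
  open import Data.Fin.Properties as Fin using (all?; any?)
  open import Data.Fin.Subset using (Subset)
  open import Data.Bool.Base using (true; false)
  import Data.Bool.Properties as Bool
  open import Data.Vec.Base using ([]; _∷_)
  open import Data.Vec.Properties as Vec using (∷-injectiveʳ)
  open import Data.List.Base using (List; []; _∷_; _++_; map)
  open import Data.List.Membership.Propositional using (_∈_)
  open import Data.List.Membership.Propositional.Properties using (∈-map⁺; ∈-map⁻; ∈-++⁺ˡ; ∈-++⁺ʳ)
  open import Data.List.Relation.Unary.Any using (here)
  open import Data.List.Relation.Unary.Unique.Propositional using (Unique; []; _∷_)
  open import Data.List.Relation.Unary.Unique.Propositional.Properties using (++⁺; map⁺)
  open import Data.List.Relation.Unary.All using ([])
  open import Data.Product using (∃; _×_; _,_)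
  import Data.Product.Properties as Product
  open import Relation.Nullary using (¬_; Dec)
  open import Relation.Nullary.Decidable using (_×-dec_; _→-dec_; ¬?; map′)
  open import Relation.Binary.Definitions using (DecidableEquality)
  open import Relation.Binary.PropositionalEquality using (refl; sym; subst)

  subsets : ∀ m → List (Subset m)
  subsets zero    = [] ∷ []
  subsets (suc m) = map (true ∷_) (subsets m) ++ map (false ∷_) (subsets m)

  ∈-subsets : ∀ {m} (K : Subset m) → K ∈ subsets m
  ∈-subsets []          = here refl
  ∈-subsets (true ∷ K)  = ∈-++⁺ˡ (∈-map⁺ (true ∷_) (∈-subsets K))
  ∈-subsets {suc m} (false ∷ K) = ∈-++⁺ʳ (map (true ∷_) (subsets m)) (∈-map⁺ (false ∷_) (∈-subsets K))

  subsets-unique : ∀ m → Unique (subsets m)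
  subsets-unique zero    = [] ∷ []
  subsets-unique (suc m) = ++⁺ (map⁺ ∷-injectiveʳ (subsets-unique m)) (map⁺ ∷-injectiveʳ (subsets-unique m)) disjoint
    where
    disjoint : ∀ {K} → ¬ (K ∈ map (true ∷_) (subsets m) × K ∈ map (false ∷_) (subsets m))
    disjoint (K∈₁ , K∈₂) with ∈-map⁻ (true ∷_) K∈₁ | ∈-map⁻ (false ∷_) K∈₂
    ... | _ , _ , refl | _ , _ , ()

  _≟_ : DecidableEquality (D n)
  _≟_ = Product.≡-dec Fin._≟_ Bool._≟_

  _≟ₛ_ : DecidableEquality (Sub n)
  _≟ₛ_ = Vec.≡-dec Bool._≟_

  ∀? : ∀ {P : D n → Set} → (∀ x → Dec (P x)) → Dec (∀ x → P x)
  ∀? {P} P? = map′ (λ ∀P x → subst P (decode-code x) (∀P (code n x))) (λ ∀P f → ∀P (decode f)) (all? (λ f → P? (decode f)))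

  ∃? : ∀ {P : D n → Set} → (∀ x → Dec (P x)) → Dec (∃ P)
  ∃? {P} P? = map′ (λ (f , P[f]) → decode f , P[f]) (λ (x , Px) → code n x , subst P (sym (decode-code x)) Px) (any? (λ f → P? (decode f)))

  isSubgroup? : ∀ K → Dec (IsSubgroup n K)
  isSubgroup? K = one n ∈ₛ? K
    ×-dec ∀? (λ x → ∀? (λ y → x ∈ₛ? K →-dec y ∈ₛ? K →-dec mul n x y ∈ₛ? K))
    ×-dec ∀? (λ x → x ∈ₛ? K →-dec inv n x ∈ₛ? K)

  isNormal? : ∀ K → Dec (IsNormal n K)
  isNormal? K = ∀? (λ g → ∀? (λ h → h ∈ₛ? K →-dec mul n (mul n g h) (inv n g) ∈ₛ? K))

  isVertex? : ∀ K → Dec (IsVertex n K)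
  isVertex? K = isSubgroup? K ×-dec ∃? (λ x → ¬? (x ∈ₛ? K)) ×-dec ¬? (isNormal? K)

  prodSub? : ∀ H K → Dec (ProdSub n H K)
  prodSub? H K = ∀? λ h → ∀? λ k → h ∈ₛ? H →-dec k ∈ₛ? K →-dec
    ∃? λ k' → ∃? λ h' → k' ∈ₛ? K ×-dec h' ∈ₛ? H ×-dec (mul n h k ≟ mul n k' h')

  adjacent? : ∀ H K → Dec (Adjacent n H K)
  adjacent? H K = isVertex? K ×-dec ¬? (H ≟ₛ K) ×-dec (prodSub? H K ×-dec prodSub? K H)

module Degree (n : ℕ) .{{_ : NonZero n}} where

  open Counting
  open Parity using (parity-suc-cong; 2∣⇒parity≡0ℙ; parity≡0ℙ⇒2∣)
  open Divisors
  open Subgroups n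
  open Classification n
  open Decidability n
  open import Data.Nat.Base as ℕ using (suc; _≤_; _*_; _^_; _+_; parity)
  open import Data.Nat.DivMod using (_mod_)
  open import Data.Nat.Divisibility using (_∣_; ∣-refl)
  open import Data.Parity.Base using (0ℙ)
  open import Data.Fin.Base using (Fin)
  open import Data.Bool.Base using (true)
  open import Data.List.Base using (List; _∷_; length; filter)
  open import Data.List.Membership.Propositional using (_∈_)
  open import Data.List.Membership.Propositional.Properties using (∈-filter⁻; ∈-filter⁺)
  open import Data.List.Relation.Unary.Any using (here; there)
  open import Data.List.Relation.Unary.Unique.Propositional using (Unique)
  open import Data.List.Relation.Unary.Unique.Propositional.Properties using (filter⁺)
  open import Data.Product using (_×_; _,_; proj₁; proj₂)
  open import Function.Bundles using (_⇔_; mk⇔; Equivalence)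
  open import Relation.Nullary using (¬_; yes; no)
  open import Relation.Binary.PropositionalEquality using (_≡_; refl; sym; trans; cong; module ≡-Reasoning)

  -- Conjugation by a reflection τ ∈ H permutes the neighbours of H; its fixed neighbours,
  -- together with H, are all the τ-invariant vertices.
  module _ {H : Sub n} (H-vertex : IsVertex n H) {i : Fin n} (τ∈H : (i , true) ∈ₛ H)
           {L : List (Sub n)} (!L : Unique L) (∈L : ∀ K → K ∈ L ⇔ Adjacent n H K) where

    open ReflectionConjugation n i
    open FixedVertexCount n i
    open Involution _≟ₛ_ conjugateSub

    private
      H≤G = proj₁ H-vertex
      to-adjacent : ∀ {K} → K ∈ L → Adjacent n H K
      to-adjacent {K} = Equivalence.to (∈L K)
      from-adjacent : ∀ {K} → Adjacent n H K → K ∈ L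
      from-adjacent {K} = Equivalence.from (∈L K)
      fixed⁻ : ∀ {K} → K ∈ fixedPoints L → K ∈ L × conjugateSub K ≡ K
      fixed⁻ = ∈-filter⁻ isFixed? {xs = L}

    conjugateSub-involution : IsInvolutionOn L
    conjugateSub-involution = record
      { closed     = λ K∈L → from-adjacent (conjugateSub-adjacent H≤G τ∈H (to-adjacent K∈L))
      ; involutive = λ {K} _ → conjugateSub-involutive K
      }

    length-fixedVertices : length fixedVertices ≡ suc (length (fixedPoints L))
    length-fixedVertices = length-unique-cong fixedVertices-unique (unique-∷ H∉ (filter⁺ isFixed? !L)) (λ {K} → mk⇔ (to K) from)
      where
      H∉ : ¬ H ∈ fixedPoints L
      H∉ H∈ = proj₁ (proj₂ (to-adjacent (proj₁ (fixed⁻ H∈)))) refl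
      to : ∀ K → K ∈ fixedVertices → K ∈ H ∷ fixedPoints L
      to K K∈ with Equivalence.to (∈-fixedVertices K) K∈ | H ≟ₛ K
      ... | _ | yes refl = here refl
      ... | K-vertex , fixed | no H≢K =
        there (∈-filter⁺ isFixed? (from-adjacent (K-vertex , H≢K , τ-invariant-permute H≤G τ∈H (proj₁ K-vertex) fixed)) fixed)
      from : ∀ {K} → K ∈ H ∷ fixedPoints L → K ∈ fixedVertices
      from (here refl) = Equivalence.from (∈-fixedVertices H) (H-vertex , conjugateSub-fixes H≤G τ∈H)
      from {K} (there K∈) = let K∈L , fixed = fixed⁻ K∈ in
        Equivalence.from (∈-fixedVertices K) (proj₁ (to-adjacent K∈L) , fixed)

    parity-1+degree : parity (suc (length L)) ≡ parity (length (filter odd? (large-divisors n)))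
    parity-1+degree = begin
      parity (suc (length L))                      ≡⟨ parity-suc-cong (length L) (length (fixedPoints L)) (parity-length≡parity-fixedPoints !L conjugateSub-involution) ⟩
      parity (suc (length (fixedPoints L)))        ≡⟨ cong parity (sym length-fixedVertices) ⟩
      parity (length fixedVertices)                ≡⟨ parity-fixedVertices ⟩
      parity (length (filter odd? (large-divisors n))) ∎
      where open ≡-Reasoning

  module OddPart (a m : ℕ) (n≡2^am : n ≡ 2 ^ a * m) (m-odd : ¬ 2 ∣ m) where

    parity-degree : ∀ {H} → IsVertex n H → ∀ d → HasCard n (Adjacent n H) d → parity d ≡ parity (length (divisors m))
    parity-degree {H} H-vertex d (L , !L , ∈L , refl) =
      trans (parity-suc-cong (suc (length L)) (length (filter odd? (large-divisors n))) (parity-1+degree H-vertex (proj₂ (vertex-has-reflection H-vertex)) !L ∈L))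
            (cong parity (sym (length-divisors-odd-part a m n≡2^am m-odd)))

    neighbours : Sub n → List (Sub n)
    neighbours H = filter (adjacent? H) (subsets (n + n))

    neighbours-card : ∀ H → HasCard n (Adjacent n H) (length (neighbours H))
    neighbours-card H = neighbours H , filter⁺ (adjacent? H) (subsets-unique (n + n)) ,
      (λ K → mk⇔ (λ K∈ → proj₂ (∈-filter⁻ (adjacent? H) {xs = subsets (n + n)} K∈))
                 (λ adjacent → ∈-filter⁺ (adjacent? H) (∈-subsets K) adjacent)) , refl

    eulerian⇔even-divisor-count : 3 ≤ n → Eulerian n ⇔ (parity (length (divisors m)) ≡ 0ℙ)
    eulerian⇔even-divisor-count 3≤n = mk⇔ to from
      where
      H₀ : Sub n
      H₀ = subdihedral n (0 mod n)
      H₀-vertex : IsVertex n H₀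
      H₀-vertex = subdihedral-vertex ∣-refl 3≤n
      to : Eulerian n → parity (length (divisors m)) ≡ 0ℙ
      to eulerian = let d , card , 2∣d = eulerian H₀ H₀-vertex in
        trans (sym (parity-degree H₀-vertex d card)) (2∣⇒parity≡0ℙ 2∣d)
      from : parity (length (divisors m)) ≡ 0ℙ → Eulerian n
      from even H H-vertex = length (neighbours H) , neighbours-card H ,
        parity≡0ℙ⇒2∣ _ (trans (parity-degree H-vertex _ (neighbours-card H)) even)

open Divisors
open Squares
open Degree
open import Data.Nat.Base using (ℕ; NonZero; _≤_; _*_; _^_)
open import Data.Nat.Properties using (+-identityʳ; *-identityʳ)
open import Data.Nat.Divisibility using (_∣_; ∣1⇒≡1)
open import Data.Fin.Base using (Fin)
open import Data.Product using (_×_; ∃; _,_)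
open import Function.Bundles using (_⇔_; Equivalence)
open import Function.Properties.Equivalence using () renaming (trans to ⇔-trans)
open import Relation.Nullary using (¬_; contradiction)
open import Relation.Binary.PropositionalEquality using (_≡_; refl; sym; trans)

eulerian⇔nonsquare-odd-part : ∀ {n} .{{_ : NonZero n}} → 3 ≤ n → ∀ a m → ¬ 2 ∣ m → n ≡ 2 ^ a * m →
                              Eulerian n ⇔ (¬ IsSquare m)
eulerian⇔nonsquare-odd-part {n} 3≤n a m m-odd n≡2^am =
  ⇔-trans (OddPart.eulerian⇔even-divisor-count n a m n≡2^am m-odd 3≤n)
          (even-divisor-count⇔nonsquare m {{factor-nonZero a m n≡2^am}})

eulerian⇔odd-exponent : ∀ {n} .{{_ : NonZero n}} → 3 ≤ n → ∀ a m → ¬ 2 ∣ m → n ≡ 2 ^ a * m →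
                        ∀ k (p α : Fin k → ℕ) → PrimePowerData k p α → m ≡ factorValue k p α →
                        Eulerian n ⇔ ∃ λ i → ¬ 2 ∣ α i
eulerian⇔odd-exponent 3≤n a m m-odd n≡2^am k p α factorisation refl =
  ⇔-trans (eulerian⇔nonsquare-odd-part 3≤n a m m-odd n≡2^am) (nonsquare⇔odd-exponent k p α factorisation)

corollary4p2 : (n : ℕ) .{{_ : NonZero n}} → 3 ≤ n →
    ((¬ 2 ∣ n) → (k : ℕ) (p α : Fin k → ℕ) → PrimePowerData k p α →
      n ≡ factorValue k p α → (Eulerian n ⇔ ∃ λ i → ¬ 2 ∣ α i))
  × ((a : ℕ) → 2 ≤ a → n ≡ 2 ^ a → ¬ Eulerian n)
  × ((a n' : ℕ) → 1 ≤ a → ¬ 2 ∣ n' → n ≡ 2 ^ a * n' →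
      (k : ℕ) (p α : Fin k → ℕ) → PrimePowerData k p α →
      n' ≡ factorValue k p α → (Eulerian n ⇔ ∃ λ i → ¬ 2 ∣ α i))
corollary4p2 n 3≤n =
    (λ n-odd → eulerian⇔odd-exponent 3≤n 0 n n-odd (sym (+-identityʳ n)))
  , (λ a _ n≡2^a eulerian →
       Equivalence.to (eulerian⇔nonsquare-odd-part 3≤n a 1 1-odd (trans n≡2^a (sym (*-identityʳ (2 ^ a))))) eulerian (1 , refl))
  , (λ a n' _ → eulerian⇔odd-exponent 3≤n a n')
  where
  1-odd : ¬ 2 ∣ 1
  1-odd 2∣1 = contradiction (∣1⇒≡1 2∣1) λ ()
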